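{- Let $a_n$ denote the number of stabilized-interval-free permutations of $[n]=\{1,\dots,n\}$ for $n\ge1$, and $a_0=1$. Then $a_0=a_1=1$ and for all $n\ge 2$, \[ a_n = \sum_{j=2}^{n-2} (j-1)\, a_j\, a_{n-j} + (n-1)\, a_{n-1}, \] where a vacuous sum is $0$.
   Context: A permutation $\sigma$ of $[n]$ stabilizes a subset $I\subseteq[n]$ if $\sigma(I)=I$. A permutation $\sigma$ of $[n]$ is stabilized-interval-free (SIF) if there is no set $\{i,i+1,\dots,j\}$ with $1\le i\le j\le n$ and $\{i,\dots,j\}\ne[n]$ such that $\sigma(\{i,\dots,j\})=\{i,\dots,j\}$. The empty permutation is counted as SIF, so $a_0=1$. -}

module Defs where

open import Data.Nat using (ℕ; zero; suc; _+_; _*_; _∸_)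
import Data.Nat as ℕ
open import Data.Fin using (Fin; toℕ; _≤_; _≤?_)
import Data.Fin.Properties as FinP
open import Data.Vec using (Vec; []; _∷_; lookup)
open import Data.List using (List; []; _∷_; map; concatMap; filter; length; upTo; allFin)
open import Data.Nat.ListAction using (sum)
open import Data.Product using (_×_; _,_; ∃)
open import Relation.Binary.PropositionalEquality using (_≡_)
open import Relation.Nullary using (¬_; Dec)
open import Relation.Nullary.Decidable using (_×-dec_; _→-dec_; ¬?)

-- Permutations of [n] are represented in one-line notation, with [n]
-- identified with Fin n = {0,…,n-1}:  σ(x) = lookup v x.

allVecs : (n k : ℕ) → List (Vec (Fin n) k)
allVecs n zero    = [] ∷ []
allVecs n (suc k) = concatMap (λ x → map (x ∷_) (allVecs n k)) (allFin n)

IsPerm : ∀ {n} → Vec (Fin n) n → Set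
IsPerm {n} v = (∀ x y → lookup v x ≡ lookup v y → x ≡ y)
             × (∀ y → ∃ λ x → lookup v x ≡ y)

InInterval : ∀ {n} → Fin n → Fin n → Fin n → Set
InInterval i j x = (i ≤ x) × (x ≤ j)

Stabilizes : ∀ {n} → Vec (Fin n) n → Fin n → Fin n → Set
Stabilizes v i j =
  (∀ x → InInterval i j x → InInterval i j (lookup v x))
  × (∀ y → InInterval i j y → ∃ λ x → InInterval i j x × (lookup v x ≡ y))

IsWhole : ∀ {n} → Fin n → Fin n → Set
IsWhole {n} i j = (toℕ i ≡ 0) × (suc (toℕ j) ≡ n)

IsSIF : ∀ {n} → Vec (Fin n) n → Set
IsSIF v = ∀ i j → i ≤ j → ¬ IsWhole i j → ¬ Stabilizes v i j

IsSIFPerm : ∀ {n} → Vec (Fin n) n → Set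
IsSIFPerm v = IsPerm v × IsSIF v

private
  inI? : ∀ {n} (i j x : Fin n) → Dec (InInterval i j x)
  inI? i j x = (i ≤? x) ×-dec (x ≤? j)

  isWhole? : ∀ {n} (i j : Fin n) → Dec (IsWhole i j)
  isWhole? {n} i j = (toℕ i ℕ.≟ 0) ×-dec (suc (toℕ j) ℕ.≟ n)

  stab? : ∀ {n} (v : Vec (Fin n) n) i j → Dec (Stabilizes v i j)
  stab? v i j =
    FinP.all? (λ x → inI? i j x →-dec inI? i j (lookup v x))
    ×-dec FinP.all? (λ y → inI? i j y →-dec
            FinP.any? (λ x → inI? i j x ×-dec (lookup v x FinP.≟ y)))

  isPerm? : ∀ {n} (v : Vec (Fin n) n) → Dec (IsPerm v)
  isPerm? v =
    FinP.all? (λ x → FinP.all? (λ y → (lookup v x FinP.≟ lookup v y) →-dec (x FinP.≟ y)))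
    ×-dec FinP.all? (λ y → FinP.any? (λ x → lookup v x FinP.≟ y))

  isSIF? : ∀ {n} (v : Vec (Fin n) n) → Dec (IsSIF v)
  isSIF? v = FinP.all? (λ i → FinP.all? (λ j →
    (i ≤? j) →-dec (¬? (isWhole? i j) →-dec ¬? (stab? v i j))))

isSIFPerm? : ∀ {n} (v : Vec (Fin n) n) → Dec (IsSIFPerm v)
isSIFPerm? v = isPerm? v ×-dec isSIF? v

-- a n = number of SIF permutations of [n]  (n = 0 gives the empty
-- permutation, which is vacuously SIF, so a 0 = 1 by definition)
a : ℕ → ℕ
a n = length (filter isSIFPerm? (allVecs n n))

-- Σ_{j=lo}^{hi} f j  (0 when hi < lo)
sumFromTo : ℕ → ℕ → (ℕ → ℕ) → ℕ
sumFromTo lo hi f = sum (map (λ k → f (lo + k)) (upTo (suc hi ∸ lo)))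

-- Let σ be a SIF permutation of [0, n), n = m + 1 ≥ 2, and let τ be σ with the top element m
-- cut out of its cycle. If τ is SIF, σ is recovered from τ and the preimage i < m of m: this
-- gives (n - 1) a_{n-1}. Otherwise take a longest proper interval [g, g + k) stabilized by τ.
-- It contains the preimage of m, which forces 0 < g and g + k < m; then σ stabilizes the block
-- [g, g + k) ∪ {m} and its complement, and restricts to SIF permutations β of the block (size
-- k + 1 = n - j) and α of the complement (size j), with 0 < g < j. Conversely every such
-- (j, g, α, β) glues to a SIF permutation σ for which τ stabilizes [g, g + k) and every proper
-- interval stabilized by τ lies inside [g, g + k); so σ determines (j, g, α, β), and these
-- account for the sum of (j - 1) a_j a_{n-j}.

module Submission where

open import Defs
open import Data.Empty using (⊥-elim)
open import Data.Fin using (Fin; toℕ; fromℕ<) renaming (zero to fzero; suc to fsuc)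
import Data.Fin as Fin
open import Data.Fin.Properties using (toℕ-injective; toℕ<n; toℕ-fromℕ<)
open import Data.List using (List; []; _∷_; map; concatMap; filter; length; _++_; upTo; allFin; cartesianProductWith)
open import Data.List.Membership.Propositional using (_∈_; lose; find)
open import Data.List.Membership.Propositional.Properties
  using (∈-++⁺ˡ; ∈-++⁺ʳ; ∈-++⁻; ∈-map⁺; ∈-map⁻; ∈-allFin; ∈-filter⁺; ∈-filter⁻; ∈-upTo⁺; ∈-upTo⁻; ∈-concatMap⁺; ∈-concatMap⁻)
open import Data.List.Membership.Propositional.Properties.WithK using (unique∧set⇒bag)
import Data.List.Membership.Setoid.Properties as SetoidMembership
open import Data.List.Properties using (length-++; length-map; length-upTo; map-cong; length-tabulate)
open import Data.List.Relation.Binary.BagAndSetEquality using (∼bag⇒↭)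
open import Data.List.Relation.Binary.Disjoint.Propositional using (Disjoint)
open import Data.List.Relation.Binary.Permutation.Propositional.Properties using (↭-length)
open import Data.List.Relation.Unary.All as All using ([])
open import Data.List.Relation.Unary.AllPairs using (_∷_)
open import Data.List.Relation.Unary.Any using (here; there)
open import Data.List.Relation.Unary.Unique.Propositional using (Unique; [])
open import Data.List.Relation.Unary.Unique.Propositional.Properties
  using (map⁺; filter⁺; allFin⁺; upTo⁺; ++⁺; cartesianProductWith⁺)
open import Data.Nat using (ℕ; zero; suc; _+_; _*_; _∸_; _≤_; _<_; _≥_; _⊓_; z≤n; s≤s; z<s; _≤?_; _<?_; _≟_)
open import Data.Nat.ListAction using (sum)
open import Data.Nat.Properties
open import Data.Product using (_×_; _,_; proj₁; proj₂; ∃)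
open import Data.Sum using (_⊎_; inj₁; inj₂)
open import Data.Vec using (Vec; []; _∷_; lookup; tabulate)
open import Data.Vec.Properties using (lookup∘tabulate; ∷-injectiveˡ; ∷-injectiveʳ)
open import Function using (_∘_)
open import Function.Bundles using (_⇔_; mk⇔)
open import Relation.Binary.PropositionalEquality
open import Relation.Nullary using (¬_; Dec; yes; no)
open import Relation.Nullary.Decidable using (toSum; map′; _×-dec_; _⊎-dec_; _→-dec_; ¬?)

module _ {A : Set} where

  unique-⇔-length : {xs ys : List A} → Unique xs → Unique ys →
                    (∀ {z} → z ∈ xs ⇔ z ∈ ys) → length xs ≡ length ys
  unique-⇔-length ux uy xs⇔ys = ↭-length (∼bag⇒↭ (unique∧set⇒bag ux uy xs⇔ys))

module _ {A B : Set} (f : A → B) where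

  map-unique : {xs : List A} → Unique xs → (∀ {x y} → x ∈ xs → y ∈ xs → f x ≡ f y → x ≡ y) → Unique (map f xs)
  map-unique {[]} _ _ = []
  map-unique {x ∷ xs} (x∉xs ∷ uxs) inj =
    All.tabulate fx∉ ∷ map-unique uxs (λ x∈ y∈ → inj (there x∈) (there y∈))
    where
      fx∉ : ∀ {z} → z ∈ map f xs → f x ≢ z
      fx∉ z∈ fx≡z with ∈-map⁻ f z∈
      ... | y , y∈ , refl = All.lookup x∉xs y∈ (inj (here refl) (there y∈) fx≡z)

module _ {A B : Set} (f : A → List B) where

  concatMap-unique : {xs : List A} → Unique xs →
    (∀ {x} → x ∈ xs → Unique (f x)) →
    (∀ {x y z} → x ∈ xs → y ∈ xs → z ∈ f x → z ∈ f y → x ≡ y) →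
    Unique (concatMap f xs)
  concatMap-unique {[]} _ _ _ = []
  concatMap-unique {x ∷ xs} (x∉xs ∷ uxs) uf tag =
    ++⁺ (uf (here refl))
        (concatMap-unique uxs (λ x∈ → uf (there x∈)) (λ x∈ y∈ → tag (there x∈) (there y∈)))
        disjoint
    where
      disjoint : Disjoint (f x) (concatMap f xs)
      disjoint (z∈fx , z∈rest) with find (∈-concatMap⁻ f z∈rest)
      ... | y , y∈ , z∈fy = All.lookup x∉xs y∈ (tag (here refl) (there y∈) z∈fx z∈fy)

  length-concatMap : (xs : List A) → length (concatMap f xs) ≡ sum (map (λ x → length (f x)) xs)
  length-concatMap [] = refl
  length-concatMap (x ∷ xs) = trans (length-++ (f x)) (cong (length (f x) +_) (length-concatMap xs))

  length-concatMap-const : (c : ℕ) → (∀ x → length (f x) ≡ c) →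
                           (xs : List A) → length (concatMap f xs) ≡ length xs * c
  length-concatMap-const c lf [] = refl
  length-concatMap-const c lf (x ∷ xs) =
    trans (length-++ (f x)) (cong₂ _+_ (lf x) (length-concatMap-const c lf xs))

module _ {A B C : Set} (f : A → B → C) where

  ∈-cartesianProductWith⁺ : {xs : List A} {ys : List B} {x : A} {y : B} →
                            x ∈ xs → y ∈ ys → f x y ∈ cartesianProductWith f xs ys
  ∈-cartesianProductWith⁺ = SetoidMembership.∈-cartesianProductWith⁺ (setoid A) (setoid B) (setoid C) (cong₂ f)

  ∈-cartesianProductWith⁻ : (xs : List A) (ys : List B) {z : C} → z ∈ cartesianProductWith f xs ys →
                            ∃ λ x → ∃ λ y → x ∈ xs × y ∈ ys × z ≡ f x y
  ∈-cartesianProductWith⁻ = SetoidMembership.∈-cartesianProductWith⁻ (setoid A) (setoid B) (setoid C) f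

  cartesianProductWith-unique : {xs : List A} {ys : List B} → Unique xs → Unique ys →
    (∀ {x x′ y y′} → x ∈ xs → x′ ∈ xs → y ∈ ys → y′ ∈ ys → f x y ≡ f x′ y′ → x ≡ x′ × y ≡ y′) →
    Unique (cartesianProductWith f xs ys)
  cartesianProductWith-unique {[]} _ _ _ = []
  cartesianProductWith-unique {x ∷ xs} {ys} (x∉xs ∷ uxs) uys inj =
    ++⁺ (map-unique (f x) uys (λ y∈ y′∈ eq → proj₂ (inj (here refl) (here refl) y∈ y′∈ eq)))
        (cartesianProductWith-unique uxs uys (λ x∈ x′∈ → inj (there x∈) (there x′∈)))
        disjoint
    where
      disjoint : Disjoint (map (f x) ys) (cartesianProductWith f xs ys)
      disjoint (z∈ , z∈rest) with ∈-map⁻ (f x) z∈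
                               | ∈-cartesianProductWith⁻ xs ys z∈rest
      ... | y , y∈ , refl | x′ , y′ , x′∈ , y′∈ , eq =
        All.lookup x∉xs x′∈ (proj₁ (inj (here refl) (there x′∈) y∈ y′∈ eq))

  length-cartesianProductWith : (xs : List A) (ys : List B) →
    length (cartesianProductWith f xs ys) ≡ length xs * length ys
  length-cartesianProductWith [] ys = refl
  length-cartesianProductWith (x ∷ xs) ys =
    trans (length-++ (map (f x) ys))
          (cong₂ _+_ (length-map (f x) ys) (length-cartesianProductWith xs ys))

infix 4 _∈[_,_⟩ _≈[_]_

_∈[_,_⟩ : ℕ → ℕ → ℕ → Set
x ∈[ p , q ⟩ = p ≤ x × x < q

_∈[_,_⟩? : ∀ x p q → Dec (x ∈[ p , q ⟩)
x ∈[ p , q ⟩? = (p ≤? x) ×-dec (x <? q)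

-- Permutations of [0, n) are functions ℕ → ℕ considered below n only; the vectors of Defs
-- are converted to and from them by toFun and fromFun.
Bounded : ℕ → (ℕ → ℕ) → Set
Bounded n f = ∀ {x} → x < n → f x < n

record Perm (n : ℕ) (f : ℕ → ℕ) : Set where
  field
    bounded    : Bounded n f
    injective  : ∀ {x y} → x < n → y < n → f x ≡ f y → x ≡ y
    surjective : ∀ {y} → y < n → ∃ λ x → x < n × f x ≡ y
open Perm public

record Stab (f : ℕ → ℕ) (p q : ℕ) : Set where
  field
    into : ∀ {x} → x ∈[ p , q ⟩ → f x ∈[ p , q ⟩
    onto : ∀ {y} → y ∈[ p , q ⟩ → ∃ λ x → x ∈[ p , q ⟩ × f x ≡ y
open Stab public

Whole : ℕ → ℕ → ℕ → Set
Whole n p q = p ≡ 0 × q ≡ n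

SIF : ℕ → (ℕ → ℕ) → Set
SIF n f = ∀ {p q} → p < q → q ≤ n → Stab f p q → Whole n p q

ProperStab : ℕ → (ℕ → ℕ) → ℕ → ℕ → Set
ProperStab n f p q = p < q × q ≤ n × ¬ Whole n p q × Stab f p q

_≈[_]_ : (ℕ → ℕ) → ℕ → (ℕ → ℕ) → Set
f ≈[ n ] g = ∀ {x} → x < n → f x ≡ g x

≈-sym : ∀ {n f g} → f ≈[ n ] g → g ≈[ n ] f
≈-sym f≈g x<n = sym (f≈g x<n)

stab-resp : ∀ {f f′ p q} → (∀ {x} → x ∈[ p , q ⟩ → f x ≡ f′ x) → Stab f p q → Stab f′ p q
stab-resp {p = p} {q} f≡f′ S = record
  { into = λ x∈ → subst (_∈[ p , q ⟩) (f≡f′ x∈) (into S x∈)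
  ; onto = λ y∈ → let x , x∈ , fx≡y = onto S y∈ in x , x∈ , trans (sym (f≡f′ x∈)) fx≡y }

perm-resp : ∀ {n f f′} → f ≈[ n ] f′ → Perm n f → Perm n f′
perm-resp {n} f≈f′ P = record
  { bounded    = λ x<n → subst (_< n) (f≈f′ x<n) (bounded P x<n)
  ; injective  = λ x<n y<n eq → injective P x<n y<n (trans (f≈f′ x<n) (trans eq (sym (f≈f′ y<n))))
  ; surjective = λ y<n → let x , x<n , fx≡y = surjective P y<n in x , x<n , trans (sym (f≈f′ x<n)) fx≡y }

SIF-resp : ∀ {n f f′} → f ≈[ n ] f′ → SIF n f → SIF n f′
SIF-resp f≈f′ H p<q q≤n S = H p<q q≤n (stab-resp (λ x∈ → sym (f≈f′ (<-≤-trans (proj₂ x∈) q≤n))) S)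

properStab-resp : ∀ {n f f′ p q} → f ≈[ n ] f′ → ProperStab n f p q → ProperStab n f′ p q
properStab-resp f≈f′ (p<q , q≤n , proper , S) =
  p<q , q≤n , proper , stab-resp (λ x∈ → f≈f′ (<-≤-trans (proj₂ x∈) q≤n)) S

module _ {n : ℕ} {f : ℕ → ℕ} (P : Perm n f) where

  stab-compl : ∀ {p q} → Stab f p q → q ≤ n →
               ∀ {x} → x < n → ¬ x ∈[ p , q ⟩ → ¬ f x ∈[ p , q ⟩
  stab-compl S q≤n x<n x∉ fx∈ with onto S fx∈
  ... | x′ , x′∈ , fx′≡fx = x∉ (subst (_∈[ _ , _ ⟩) (injective P (<-≤-trans (proj₂ x′∈) q≤n) x<n fx′≡fx) x′∈)

  stab-intro : ∀ {p q} → q ≤ n →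
               (∀ {x} → x ∈[ p , q ⟩ → f x ∈[ p , q ⟩) →
               (∀ {x} → x < n → ¬ x ∈[ p , q ⟩ → ¬ f x ∈[ p , q ⟩) → Stab f p q
  stab-intro {p} {q} q≤n into′ compl = record { into = into′ ; onto = onto′ }
    where
      onto′ : ∀ {y} → y ∈[ p , q ⟩ → ∃ λ x → x ∈[ p , q ⟩ × f x ≡ y
      onto′ y∈ with surjective P (<-≤-trans (proj₂ y∈) q≤n)
      ... | x , x<n , fx≡y with x ∈[ p , q ⟩?
      ...   | yes x∈ = x , x∈ , fx≡y
      ...   | no x∉ = ⊥-elim (compl x<n x∉ (subst (_∈[ p , q ⟩) (sym fx≡y) y∈))

  stab-suffix⇒prefix : ∀ {p} → p ≤ n → Stab f p n → Stab f 0 p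
  stab-suffix⇒prefix {p} p≤n S = stab-intro p≤n into′ compl
    where
      into′ : ∀ {x} → x ∈[ 0 , p ⟩ → f x ∈[ 0 , p ⟩
      into′ {x} (_ , x<p) with p ≤? f x
      ... | no p≰fx = z≤n , ≰⇒> p≰fx
      ... | yes p≤fx = ⊥-elim (stab-compl S ≤-refl x<n (λ x∈ → <⇒≱ x<p (proj₁ x∈)) (p≤fx , bounded P x<n))
        where
          x<n : x < n
          x<n = <-≤-trans x<p p≤n
      compl : ∀ {x} → x < n → ¬ x ∈[ 0 , p ⟩ → ¬ f x ∈[ 0 , p ⟩
      compl x<n x∉ fx∈ = <⇒≱ (proj₂ fx∈) (proj₁ (into S (≮⇒≥ (λ x<p → x∉ (z≤n , x<p)) , x<n)))

  stab-prefix⇒suffix : ∀ {q} → q ≤ n → Stab f 0 q → Stab f q n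
  stab-prefix⇒suffix {q} q≤n S = stab-intro ≤-refl into′ compl
    where
      into′ : ∀ {x} → x ∈[ q , n ⟩ → f x ∈[ q , n ⟩
      into′ (q≤x , x<n) =
        ≮⇒≥ (λ fx<q → stab-compl S q≤n x<n (λ x∈ → <⇒≱ (proj₂ x∈) q≤x) (z≤n , fx<q)) , bounded P x<n
      compl : ∀ {x} → x < n → ¬ x ∈[ q , n ⟩ → ¬ f x ∈[ q , n ⟩
      compl x<n x∉ fx∈ = <⇒≱ (proj₂ (into S (z≤n , ≰⇒> (λ q≤x → x∉ (q≤x , x<n))))) (proj₁ fx∈)

  -- If [p, n) is stabilized then so is [0, p), so intervals reaching the top need no check.
  SIF-intro : (∀ {p q} → p < q → q < n → ¬ Stab f p q) → SIF n f
  SIF-intro none {p} {q} p<q q≤n S with m≤n⇒m<n∨m≡n q≤n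
  ... | inj₁ q<n = ⊥-elim (none p<q q<n S)
  ... | inj₂ refl with p ≟ 0
  ...   | yes p≡0 = p≡0 , refl
  ...   | no p≢0 = ⊥-elim (none (n≢0⇒n>0 p≢0) p<q (stab-suffix⇒prefix (<⇒≤ p<q) S))

stab-∪ : ∀ {f p q p′ q′} → Stab f p q → Stab f p′ q′ → p ≤ p′ → p′ ≤ q → q ≤ q′ → Stab f p q′
stab-∪ {f} {p} {q} {p′} {q′} S S′ p≤p′ p′≤q q≤q′ = record { into = into′ ; onto = onto′ }
  where
    into′ : ∀ {x} → x ∈[ p , q′ ⟩ → f x ∈[ p , q′ ⟩
    into′ {x} (p≤x , x<q′) with x <? q
    ... | yes x<q = let p≤fx , fx<q = into S (p≤x , x<q) in p≤fx , <-≤-trans fx<q q≤q′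
    ... | no x≮q = let p′≤fx , fx<q′ = into S′ (≤-trans p′≤q (≮⇒≥ x≮q) , x<q′) in ≤-trans p≤p′ p′≤fx , fx<q′
    onto′ : ∀ {y} → y ∈[ p , q′ ⟩ → ∃ λ x → x ∈[ p , q′ ⟩ × f x ≡ y
    onto′ {y} (p≤y , y<q′) with y <? q
    ... | yes y<q = let x , (p≤x , x<q) , fx≡y = onto S (p≤y , y<q) in x , (p≤x , <-≤-trans x<q q≤q′) , fx≡y
    ... | no y≮q = let x , (p′≤x , x<q′) , fx≡y = onto S′ (≤-trans p′≤q (≮⇒≥ y≮q) , y<q′) in
                   x , (≤-trans p≤p′ p′≤x , x<q′) , fx≡y

-- Within [0, j), the preimage of [p, q) under e is [p′, q′).
record Preimage (e : ℕ → ℕ) (j p′ q′ p q : ℕ) : Set where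
  field
    q′≤j  : q′ ≤ j
    maps  : ∀ {y} → y < j → y ∈[ p′ , q′ ⟩ → e y ∈[ p , q ⟩
    pulls : ∀ {y} → y < j → e y ∈[ p , q ⟩ → y ∈[ p′ , q′ ⟩

module _ {j : ℕ} {f α e : ℕ → ℕ} {p′ q′ p q : ℕ} (W : Preimage e j p′ q′ p q)
         (commute : ∀ {y} → y < j → f (e y) ≡ e (α y)) where
  open Preimage W

  stab-pullback : Perm j α → (∀ {y y′} → y < j → y′ < j → e y ≡ e y′ → y ≡ y′) →
    (∀ {x z} → x ∈[ p , q ⟩ → z < j → f x ≡ e z → ∃ λ y → y < j × e y ≡ x) →
    Stab f p q → Stab α p′ q′
  stab-pullback A e-inj closed S = record { into = into′ ; onto = onto′ }
    where
      into′ : ∀ {y} → y ∈[ p′ , q′ ⟩ → α y ∈[ p′ , q′ ⟩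
      into′ {y} y∈ = pulls (bounded A y<j) (subst (_∈[ p , q ⟩) (commute y<j) (into S (maps y<j y∈)))
        where
          y<j : y < j
          y<j = <-≤-trans (proj₂ y∈) q′≤j
      onto′ : ∀ {z} → z ∈[ p′ , q′ ⟩ → ∃ λ y → y ∈[ p′ , q′ ⟩ × α y ≡ z
      onto′ z∈ with onto S (maps (<-≤-trans (proj₂ z∈) q′≤j) z∈)
      ... | x , x∈ , fx≡ez with closed x∈ (<-≤-trans (proj₂ z∈) q′≤j) fx≡ez
      ...   | y , y<j , refl =
        y , pulls y<j x∈ , e-inj (bounded A y<j) (<-≤-trans (proj₂ z∈) q′≤j) (trans (sym (commute y<j)) fx≡ez)

  stab-pushforward : (∀ {x} → x ∈[ p , q ⟩ → ∃ λ y → y < j × e y ≡ x) → Stab α p′ q′ → Stab f p q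
  stab-pushforward covers S = record { into = into′ ; onto = onto′ }
    where
      into′ : ∀ {x} → x ∈[ p , q ⟩ → f x ∈[ p , q ⟩
      into′ x∈ with covers x∈
      ... | y , y<j , refl = let αy∈ = into S (pulls y<j x∈) in
        subst (_∈[ p , q ⟩) (sym (commute y<j)) (maps (<-≤-trans (proj₂ αy∈) q′≤j) αy∈)
      onto′ : ∀ {z} → z ∈[ p , q ⟩ → ∃ λ x → x ∈[ p , q ⟩ × f x ≡ z
      onto′ z∈ with covers z∈
      ... | y′ , y′<j , refl with onto S (pulls y′<j z∈)
      ...   | y , y∈ , refl = e y , maps (<-≤-trans (proj₂ y∈) q′≤j) y∈ , commute (<-≤-trans (proj₂ y∈) q′≤j)

-- remove m σ cuts m out of its cycle in σ; insert m τ i puts m into the cycle of τ right after i.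
remove : ℕ → (ℕ → ℕ) → ℕ → ℕ
remove m σ x with σ x ≟ m
... | yes _ = σ m
... | no _ = σ x

insert : ℕ → (ℕ → ℕ) → ℕ → ℕ → ℕ
insert m τ i x with x ≟ i
... | yes _ = m
... | no _ with x ≟ m
...   | yes _ = τ i
...   | no _ = τ x

redirect : ℕ → ℕ → ℕ → ℕ
redirect m i x with x ≟ m
... | yes _ = i
... | no _ = x

module _ (m : ℕ) where

  remove-hit : ∀ σ {x} → σ x ≡ m → remove m σ x ≡ σ m
  remove-hit σ {x} σx≡m with σ x ≟ m
  ... | yes _ = refl
  ... | no σx≢m = ⊥-elim (σx≢m σx≡m)

  remove-miss : ∀ σ {x} → σ x ≢ m → remove m σ x ≡ σ x
  remove-miss σ {x} σx≢m with σ x ≟ m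
  ... | yes σx≡m = ⊥-elim (σx≢m σx≡m)
  ... | no _ = refl

  insert-at : ∀ τ i → insert m τ i i ≡ m
  insert-at τ i with i ≟ i
  ... | yes _ = refl
  ... | no i≢i = ⊥-elim (i≢i refl)

  insert-top : ∀ τ {i} → m ≢ i → insert m τ i m ≡ τ i
  insert-top τ {i} m≢i with m ≟ i
  ... | yes m≡i = ⊥-elim (m≢i m≡i)
  ... | no _ with m ≟ m
  ...   | yes _ = refl
  ...   | no m≢m = ⊥-elim (m≢m refl)

  insert-redirect : ∀ τ {i x} → x ≢ i → insert m τ i x ≡ τ (redirect m i x)
  insert-redirect τ {i} {x} x≢i with x ≟ i
  ... | yes x≡i = ⊥-elim (x≢i x≡i)
  ... | no _ with x ≟ m
  ...   | yes _ = refl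
  ...   | no _ = refl

  insert-elsewhere : ∀ τ {i x} → x ≢ i → x ≢ m → insert m τ i x ≡ τ x
  insert-elsewhere τ {i} {x} x≢i x≢m = trans (insert-redirect τ x≢i) (cong τ (redirect-id x≢m))
    where
      redirect-id : ∀ {x} → x ≢ m → redirect m i x ≡ x
      redirect-id {x} x≢m with x ≟ m
      ... | yes x≡m = ⊥-elim (x≢m x≡m)
      ... | no _ = refl

m<1+n∧m≢n⇒m<n : ∀ {x m} → x < suc m → x ≢ m → x < m
m<1+n∧m≢n⇒m<n x<1+m x≢m = ≤∧≢⇒< (≤-pred x<1+m) x≢m

redirect-< : ∀ {m i x} → i < m → x < suc m → redirect m i x < m
redirect-< {m} {i} {x} i<m x<1+m with x ≟ m
... | yes _ = i<m
... | no x≢m = m<1+n∧m≢n⇒m<n x<1+m x≢m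

redirect-injective : ∀ {m i x y} → x ≢ i → y ≢ i → redirect m i x ≡ redirect m i y → x ≡ y
redirect-injective {m} {i} {x} {y} x≢i y≢i eq with x ≟ m | y ≟ m
... | yes refl | yes refl = refl
... | yes _ | no _ = ⊥-elim (y≢i (sym eq))
... | no _ | yes _ = ⊥-elim (x≢i eq)
... | no _ | no _ = eq

module _ {m : ℕ} where

  remove-perm : ∀ {σ} → Perm (suc m) σ → Perm m (remove m σ)
  remove-perm {σ} P = record { bounded = bounded′ ; injective = injective′ ; surjective = surjective′ }
    where
      top : m < suc m
      top = ≤-refl
      below : ∀ {x} → x < m → x < suc m
      below = m<n⇒m<1+n
      σm≢m : ∀ {x} → x < m → σ x ≡ m → σ m ≢ m
      σm≢m x<m σx≡m σm≡m = <⇒≢ x<m (injective P (below x<m) top (trans σx≡m (sym σm≡m)))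
      bounded′ : ∀ {x} → x < m → remove m σ x < m
      bounded′ {x} x<m with σ x ≟ m
      ... | yes σx≡m = m<1+n∧m≢n⇒m<n (bounded P top) (σm≢m x<m σx≡m)
      ... | no σx≢m = m<1+n∧m≢n⇒m<n (bounded P (below x<m)) σx≢m
      injective′ : ∀ {x y} → x < m → y < m → remove m σ x ≡ remove m σ y → x ≡ y
      injective′ {x} {y} x<m y<m eq with σ x ≟ m | σ y ≟ m
      ... | yes σx≡m | yes σy≡m = injective P (below x<m) (below y<m) (trans σx≡m (sym σy≡m))
      ... | yes _ | no _ = ⊥-elim (<⇒≢ y<m (sym (injective P top (below y<m) eq)))
      ... | no _ | yes _ = ⊥-elim (<⇒≢ x<m (injective P (below x<m) top eq))
      ... | no _ | no _ = injective P (below x<m) (below y<m) eq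
      surjective′ : ∀ {y} → y < m → ∃ λ x → x < m × remove m σ x ≡ y
      surjective′ {y} y<m with surjective P (below y<m)
      ... | x , x<1+m , σx≡y with x ≟ m
      ...   | no x≢m = x , m<1+n∧m≢n⇒m<n x<1+m x≢m , trans (remove-miss m σ (λ σx≡m → <⇒≢ y<m (trans (sym σx≡y) σx≡m))) σx≡y
      ...   | yes refl with surjective P top
      ...     | x′ , x′<1+m , σx′≡m with x′ ≟ m
      ...       | yes refl = ⊥-elim (<⇒≢ y<m (trans (sym σx≡y) σx′≡m))
      ...       | no x′≢m = x′ , m<1+n∧m≢n⇒m<n x′<1+m x′≢m , trans (remove-hit m σ σx′≡m) σx≡y

  insert-bounded : ∀ {τ i} → Bounded m τ → i < m → Bounded (suc m) (insert m τ i)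
  insert-bounded {τ} {i} τ< i<m {x} x<1+m with toSum (x ≟ i)
  ... | inj₁ refl = subst (_< suc m) (sym (insert-at m τ x)) ≤-refl
  ... | inj₂ x≢i = subst (_< suc m) (sym (insert-redirect m τ x≢i)) (m<n⇒m<1+n (τ< (redirect-< i<m x<1+m)))

  insert-perm : ∀ {τ i} → Perm m τ → i < m → Perm (suc m) (insert m τ i)
  insert-perm {τ} {i} P i<m = record
    { bounded = insert-bounded (bounded P) i<m ; injective = injective′ ; surjective = surjective′ }
    where
      τ∘redirect< : ∀ {x} → x < suc m → τ (redirect m i x) < m
      τ∘redirect< x<1+m = bounded P (redirect-< i<m x<1+m)
      injective′ : ∀ {x y} → x < suc m → y < suc m → insert m τ i x ≡ insert m τ i y → x ≡ y
      injective′ {x} {y} x<1+m y<1+m eq with toSum (x ≟ i) | toSum (y ≟ i)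
      ... | inj₁ refl | inj₁ refl = refl
      ... | inj₁ refl | inj₂ y≢i = ⊥-elim (<⇒≢ (τ∘redirect< y<1+m)
              (trans (sym (insert-redirect m τ y≢i)) (trans (sym eq) (insert-at m τ x))))
      ... | inj₂ x≢i | inj₁ refl = ⊥-elim (<⇒≢ (τ∘redirect< x<1+m)
              (trans (sym (insert-redirect m τ x≢i)) (trans eq (insert-at m τ y))))
      ... | inj₂ x≢i | inj₂ y≢i = redirect-injective x≢i y≢i
              (injective P (redirect-< i<m x<1+m) (redirect-< i<m y<1+m)
                (trans (sym (insert-redirect m τ x≢i)) (trans eq (insert-redirect m τ y≢i))))
      surjective′ : ∀ {y} → y < suc m → ∃ λ x → x < suc m × insert m τ i x ≡ y
      surjective′ {y} y<1+m with toSum (y ≟ m)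
      ... | inj₁ refl = i , m<n⇒m<1+n i<m , insert-at m τ i
      ... | inj₂ y≢m with surjective P (m<1+n∧m≢n⇒m<n y<1+m y≢m)
      ...   | x , x<m , τx≡y with toSum (x ≟ i)
      ...     | inj₁ refl = m , ≤-refl , trans (insert-top m τ (λ m≡x → <⇒≢ x<m (sym m≡x))) τx≡y
      ...     | inj₂ x≢i = x , m<n⇒m<1+n x<m , trans (insert-elsewhere m τ x≢i (<⇒≢ x<m)) τx≡y

  -- A stabilized interval below the top avoids i, which is sent to m; there insert m τ i
  -- agrees with τ, so the interval would be all of [0, m), which contains i.
  insert-SIF : ∀ {τ i} → Perm m τ → SIF m τ → i < m → SIF (suc m) (insert m τ i)
  insert-SIF {τ} {i} P H i<m = SIF-intro (insert-perm P i<m) none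
    where
      none : ∀ {p q} → p < q → q < suc m → ¬ Stab (insert m τ i) p q
      none {p} {q} p<q q<1+m S with i ∈[ p , q ⟩?
      ... | yes i∈ = <⇒≱ (proj₂ (into S i∈)) (subst (q ≤_) (sym (insert-at m τ i)) (≤-pred q<1+m))
      ... | no i∉ = i∉ (i∈whole (H p<q (≤-pred q<1+m) (stab-resp agrees S)))
        where
          agrees : ∀ {x} → x ∈[ p , q ⟩ → insert m τ i x ≡ τ x
          agrees {x} x∈ = insert-elsewhere m τ (λ x≡i → i∉ (subst (_∈[ p , q ⟩) x≡i x∈))
                            (<⇒≢ (<-≤-trans (proj₂ x∈) (≤-pred q<1+m)))
          i∈whole : Whole m p q → i ∈[ p , q ⟩
          i∈whole (refl , refl) = z≤n , i<m

  remove-insert : ∀ {τ i} → Bounded m τ → i < m → remove m (insert m τ i) ≈[ m ] τ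
  remove-insert {τ} {i} τ< i<m {x} x<m with toSum (x ≟ i)
  ... | inj₁ refl = trans (remove-hit m (insert m τ x) {x} (insert-at m τ x)) (insert-top m τ (λ m≡x → <⇒≢ x<m (sym m≡x)))
  ... | inj₂ x≢i = trans (remove-miss m (insert m τ i) {x} (λ eq → <⇒≢ (τ< x<m) (trans (sym agrees) eq))) agrees
    where
      agrees : insert m τ i x ≡ τ x
      agrees = insert-elsewhere m τ x≢i (<⇒≢ x<m)

  insert-remove : ∀ {σ i} → Perm (suc m) σ → σ m ≢ m → i < suc m → σ i ≡ m →
                  insert m (remove m σ) i ≈[ suc m ] σ
  insert-remove {σ} {i} P σm≢m i<1+m σi≡m {x} x<1+m with toSum (x ≟ i)
  ... | inj₁ refl = trans (insert-at m (remove m σ) x) (sym σi≡m)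
  ... | inj₂ x≢i with toSum (x ≟ m)
  ...   | inj₁ refl = trans (insert-top m (remove m σ) (λ m≡i → σm≢m (trans (cong σ m≡i) σi≡m))) (remove-hit m σ σi≡m)
  ...   | inj₂ x≢m = trans (insert-elsewhere m (remove m σ) x≢i x≢m)
                         (remove-miss m σ (λ σx≡m → x≢i (injective P x<1+m i<1+m (trans σx≡m (sym σi≡m)))))
  SIF⇒top-moves : ∀ {σ} → 0 < m → SIF (suc m) σ → σ m ≢ m
  SIF⇒top-moves {σ} 0<m H σm≡m = <⇒≢ 0<m (sym (proj₁ (H ≤-refl ≤-refl fixed)))
    where
      only-m : ∀ {x} → x ∈[ m , suc m ⟩ → x ≡ m
      only-m (m≤x , x<1+m) = ≤-antisym (≤-pred x<1+m) m≤x
      fixed : Stab σ m (suc m)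
      fixed = record
        { into = λ x∈ → subst (_∈[ m , suc m ⟩) (sym (trans (cong σ (only-m x∈)) σm≡m)) (≤-refl , ≤-refl)
        ; onto = λ y∈ → m , (≤-refl , ≤-refl) , trans σm≡m (sym (only-m y∈)) }

  insert-injectiveʳ : ∀ {τ τ′ i i′} → Bounded m τ′ → i < m → i′ < m →
                      insert m τ i ≈[ suc m ] insert m τ′ i′ → i ≡ i′
  insert-injectiveʳ {τ} {τ′} {i} {i′} τ′< i<m i′<m eq with toSum (i ≟ i′)
  ... | inj₁ i≡i′ = i≡i′
  ... | inj₂ i≢i′ = ⊥-elim (<⇒≢ (τ′< (redirect-< i′<m (m<n⇒m<1+n i<m)))
                    (trans (sym (insert-redirect m τ′ i≢i′)) (trans (sym (eq (m<n⇒m<1+n i<m))) (insert-at m τ i))))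

  remove-resp : ∀ {σ σ′} → σ ≈[ suc m ] σ′ → remove m σ ≈[ m ] remove m σ′
  remove-resp {σ} {σ′} σ≈σ′ {x} x<m with toSum (σ x ≟ m)
  ... | inj₁ σx≡m = trans (remove-hit m σ σx≡m)
                     (trans (σ≈σ′ ≤-refl) (sym (remove-hit m σ′ (trans (sym (σ≈σ′ (m<n⇒m<1+n x<m))) σx≡m))))
  ... | inj₂ σx≢m = trans (remove-miss m σ σx≢m) (trans σx≡σ′x (sym (remove-miss m σ′ (λ σ′x≡m → σx≢m (trans σx≡σ′x σ′x≡m)))))
    where
      σx≡σ′x : σ x ≡ σ′ x
      σx≡σ′x = σ≈σ′ (m<n⇒m<1+n x<m)

  insert-resp : ∀ {τ τ′ i} → τ ≈[ m ] τ′ → i < m → insert m τ i ≈[ suc m ] insert m τ′ i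
  insert-resp {τ} {τ′} {i} τ≈τ′ i<m {x} x<1+m with toSum (x ≟ i)
  ... | inj₁ refl = trans (insert-at m τ x) (sym (insert-at m τ′ x))
  ... | inj₂ x≢i = trans (insert-redirect m τ x≢i) (trans (τ≈τ′ (redirect-< i<m x<1+m)) (sym (insert-redirect m τ′ x≢i)))

  -- Off the preimage i of m, remove m σ agrees with σ, which stabilizes no proper interval.
  remove-stab-∋ : ∀ {σ i p q} → Perm (suc m) σ → SIF (suc m) σ → i < suc m → σ i ≡ m →
                  p < q → q ≤ m → Stab (remove m σ) p q → i ∈[ p , q ⟩
  remove-stab-∋ {σ} {i} {p} {q} P H i<1+m σi≡m p<q q≤m S with i ∈[ p , q ⟩?
  ... | yes i∈ = i∈
  ... | no i∉ = ⊥-elim (<⇒≢ (s≤s q≤m) (proj₂ (H p<q (m≤n⇒m≤1+n q≤m) (stab-resp agrees S))))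
    where
      agrees : ∀ {x} → x ∈[ p , q ⟩ → remove m σ x ≡ σ x
      agrees {x} x∈ = remove-miss m σ λ σx≡m →
        i∉ (subst (_∈[ p , q ⟩) (injective P (<-≤-trans (proj₂ x∈) (m≤n⇒m≤1+n q≤m)) i<1+m (trans σx≡m (sym σi≡m))) x∈)

record Indexing (j n : ℕ) (P : ℕ → Set) (emb idx : ℕ → ℕ) : Set where
  field
    emb-<   : ∀ {y} → y < j → emb y < n
    emb-P   : ∀ {y} → y < j → P (emb y)
    idx-<   : ∀ {x} → x < n → P x → idx x < j
    idx-emb : ∀ {y} → y < j → idx (emb y) ≡ y
    emb-idx : ∀ {x} → x < n → P x → emb (idx x) ≡ x

  emb-injective : ∀ {y y′} → y < j → y′ < j → emb y ≡ emb y′ → y ≡ y′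
  emb-injective y<j y′<j eq = trans (sym (idx-emb y<j)) (trans (cong idx eq) (idx-emb y′<j))

restrict : (emb idx : ℕ → ℕ) → (ℕ → ℕ) → ℕ → ℕ
restrict emb idx σ = idx ∘ σ ∘ emb

module _ {j n : ℕ} {Q : ℕ → Set} {emb idx : ℕ → ℕ} (I : Indexing j n Q emb idx)
         {σ : ℕ → ℕ} (Pσ : Perm n σ) (σ-Q : ∀ {x} → x < n → Q x → Q (σ x)) where
  open Indexing I

  σ-emb : ∀ {y} → y < j → σ (emb y) ≡ emb (restrict emb idx σ y)
  σ-emb y<j = sym (emb-idx (bounded Pσ (emb-< y<j)) (σ-Q (emb-< y<j) (emb-P y<j)))

  restrict-perm : (∀ {x} → x < n → Q (σ x) → Q x) → Perm j (restrict emb idx σ)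
  restrict-perm Q-σ = record { bounded = bounded′ ; injective = injective′ ; surjective = surjective′ }
    where
      bounded′ : ∀ {y} → y < j → restrict emb idx σ y < j
      bounded′ y<j = idx-< (bounded Pσ (emb-< y<j)) (σ-Q (emb-< y<j) (emb-P y<j))
      injective′ : ∀ {x y} → x < j → y < j → restrict emb idx σ x ≡ restrict emb idx σ y → x ≡ y
      injective′ x<j y<j eq = emb-injective x<j y<j (injective Pσ (emb-< x<j) (emb-< y<j)
                                (trans (σ-emb x<j) (trans (cong emb eq) (sym (σ-emb y<j)))))
      surjective′ : ∀ {z} → z < j → ∃ λ x → x < j × restrict emb idx σ x ≡ z
      surjective′ {z} z<j with surjective Pσ (emb-< z<j)
      ... | x , x<n , σx≡ = idx x , idx-< x<n qx ,
              trans (cong (idx ∘ σ) (emb-idx x<n qx)) (trans (cong idx σx≡) (idx-emb z<j))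
        where
          qx : Q x
          qx = Q-σ x<n (subst Q (sym σx≡) (emb-P z<j))

module _ {P : ℕ → Set} (P? : ∀ x → Dec (P x)) (embB idxB embA idxA : ℕ → ℕ) where

  glue : (ℕ → ℕ) → (ℕ → ℕ) → ℕ → ℕ
  glue β α x with P? x
  ... | yes _ = embB (β (idxB x))
  ... | no _ = embA (α (idxA x))

module Gluing {n kb ja : ℕ} {P : ℕ → Set} (P? : ∀ x → Dec (P x)) {embB idxB embA idxA : ℕ → ℕ}
              (IB : Indexing kb n P embB idxB) (IA : Indexing ja n (¬_ ∘ P) embA idxA) where
  private
    module B = Indexing IB
    module A = Indexing IA
    glue′ : (ℕ → ℕ) → (ℕ → ℕ) → ℕ → ℕ
    glue′ = glue P? embB idxB embA idxA

  glue-inB : ∀ β α {x} → P x → glue′ β α x ≡ embB (β (idxB x))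
  glue-inB β α {x} px with P? x
  ... | yes _ = refl
  ... | no ¬px = ⊥-elim (¬px px)

  glue-inA : ∀ β α {x} → ¬ P x → glue′ β α x ≡ embA (α (idxA x))
  glue-inA β α {x} ¬px with P? x
  ... | yes px = ⊥-elim (¬px px)
  ... | no _ = refl

  glue-embB : ∀ β α {y} → y < kb → glue′ β α (embB y) ≡ embB (β y)
  glue-embB β α y<kb = trans (glue-inB β α (B.emb-P y<kb)) (cong (embB ∘ β) (B.idx-emb y<kb))

  glue-embA : ∀ β α {y} → y < ja → glue′ β α (embA y) ≡ embA (α y)
  glue-embA β α y<ja = trans (glue-inA β α (A.emb-P y<ja)) (cong (embA ∘ α) (A.idx-emb y<ja))

  restrictB-glue : ∀ {β} α → Bounded kb β → ∀ {y} → y < kb → restrict embB idxB (glue′ β α) y ≡ β y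
  restrictB-glue {β} α β< y<kb = trans (cong idxB (glue-embB β α y<kb)) (B.idx-emb (β< y<kb))

  restrictA-glue : ∀ β {α} → Bounded ja α → ∀ {y} → y < ja → restrict embA idxA (glue′ β α) y ≡ α y
  restrictA-glue β {α} α< y<ja = trans (cong idxA (glue-embA β α y<ja)) (A.idx-emb (α< y<ja))

  glue-bounded : ∀ {β α} → Bounded kb β → Bounded ja α → Bounded n (glue′ β α)
  glue-bounded {β} {α} β< α< {x} x<n with toSum (P? x)
  ... | inj₁ px = subst (_< n) (sym (glue-inB β α px)) (B.emb-< (β< (B.idx-< x<n px)))
  ... | inj₂ ¬px = subst (_< n) (sym (glue-inA β α ¬px)) (A.emb-< (α< (A.idx-< x<n ¬px)))

  glue-resp : ∀ {β β′ α α′} → β ≈[ kb ] β′ → α ≈[ ja ] α′ → glue′ β α ≈[ n ] glue′ β′ α′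
  glue-resp {β} {β′} {α} {α′} β≈β′ α≈α′ {x} x<n with toSum (P? x)
  ... | inj₁ px = trans (glue-inB β α px) (trans (cong embB (β≈β′ (B.idx-< x<n px))) (sym (glue-inB β′ α′ px)))
  ... | inj₂ ¬px = trans (glue-inA β α ¬px) (trans (cong embA (α≈α′ (A.idx-< x<n ¬px))) (sym (glue-inA β′ α′ ¬px)))

  glue-injective : ∀ {β β′ α α′} → Bounded kb β → Bounded kb β′ → Bounded ja α → Bounded ja α′ →
                   glue′ β α ≈[ n ] glue′ β′ α′ → β ≈[ kb ] β′ × α ≈[ ja ] α′
  glue-injective {β} {β′} {α} {α′} β< β′< α< α′< eq =
    (λ y<kb → trans (sym (restrictB-glue α β< y<kb)) (trans (cong idxB (eq (B.emb-< y<kb))) (restrictB-glue α′ β′< y<kb))) ,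
    (λ y<ja → trans (sym (restrictA-glue β α< y<ja)) (trans (cong idxA (eq (A.emb-< y<ja))) (restrictA-glue β′ α′< y<ja)))

  module _ {β α : ℕ → ℕ} (Pβ : Perm kb β) (Pα : Perm ja α) where

    glue-preserves-P : ∀ {x} → x < n → P x → P (glue′ β α x)
    glue-preserves-P x<n px = subst P (sym (glue-inB β α px)) (B.emb-P (bounded Pβ (B.idx-< x<n px)))

    glue-preserves-¬P : ∀ {x} → x < n → ¬ P x → ¬ P (glue′ β α x)
    glue-preserves-¬P x<n ¬px = subst (¬_ ∘ P) (sym (glue-inA β α ¬px)) (A.emb-P (bounded Pα (A.idx-< x<n ¬px)))

    glue-perm : Perm n (glue′ β α)
    glue-perm = record
      { bounded = glue-bounded (bounded Pβ) (bounded Pα) ; injective = injective′ ; surjective = surjective′ }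
      where
        injective′ : ∀ {x y} → x < n → y < n → glue′ β α x ≡ glue′ β α y → x ≡ y
        injective′ {x} {y} x<n y<n eq with toSum (P? x) | toSum (P? y)
        ... | inj₁ px | inj₁ py = trans (sym (B.emb-idx x<n px)) (trans (cong embB idx≡) (B.emb-idx y<n py))
          where
            idx≡ : idxB x ≡ idxB y
            idx≡ = injective Pβ (B.idx-< x<n px) (B.idx-< y<n py)
                     (B.emb-injective (bounded Pβ (B.idx-< x<n px)) (bounded Pβ (B.idx-< y<n py))
                       (trans (sym (glue-inB β α px)) (trans eq (glue-inB β α py))))
        ... | inj₁ px | inj₂ ¬py = ⊥-elim (glue-preserves-¬P y<n ¬py (subst P eq (glue-preserves-P x<n px)))
        ... | inj₂ ¬px | inj₁ py = ⊥-elim (glue-preserves-¬P x<n ¬px (subst P (sym eq) (glue-preserves-P y<n py)))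
        ... | inj₂ ¬px | inj₂ ¬py = trans (sym (A.emb-idx x<n ¬px)) (trans (cong embA idx≡) (A.emb-idx y<n ¬py))
          where
            idx≡ : idxA x ≡ idxA y
            idx≡ = injective Pα (A.idx-< x<n ¬px) (A.idx-< y<n ¬py)
                     (A.emb-injective (bounded Pα (A.idx-< x<n ¬px)) (bounded Pα (A.idx-< y<n ¬py))
                       (trans (sym (glue-inA β α ¬px)) (trans eq (glue-inA β α ¬py))))
        surjective′ : ∀ {y} → y < n → ∃ λ x → x < n × glue′ β α x ≡ y
        surjective′ {y} y<n with toSum (P? y)
        ... | inj₁ py with surjective Pβ (B.idx-< y<n py)
        ...   | z , z<kb , βz≡ = embB z , B.emb-< z<kb ,
                  trans (glue-embB β α z<kb) (trans (cong embB βz≡) (B.emb-idx y<n py))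
        surjective′ {y} y<n | inj₂ ¬py with surjective Pα (A.idx-< y<n ¬py)
        ...   | z , z<ja , αz≡ = embA z , A.emb-< z<ja ,
                  trans (glue-embA β α z<ja) (trans (cong embA αz≡) (A.emb-idx y<n ¬py))

  module _ {σ : ℕ → ℕ} (Pσ : Perm n σ) (σ-P : ∀ {x} → x < n → P x → P (σ x))
           (σ-¬P : ∀ {x} → x < n → ¬ P x → ¬ P (σ x)) where
    private
      β α : ℕ → ℕ
      β = restrict embB idxB σ
      α = restrict embA idxA σ

    σ-embB : ∀ {y} → y < kb → σ (embB y) ≡ embB (β y)
    σ-embB = σ-emb IB Pσ σ-P

    σ-embA : ∀ {y} → y < ja → σ (embA y) ≡ embA (α y)
    σ-embA = σ-emb IA Pσ σ-¬P

    restrictB-perm : Perm kb β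
    restrictB-perm = restrict-perm IB Pσ σ-P P-σ
      where
        P-σ : ∀ {x} → x < n → P (σ x) → P x
        P-σ {x} x<n pσx with P? x
        ... | yes px = px
        ... | no ¬px = ⊥-elim (σ-¬P x<n ¬px pσx)

    restrictA-perm : Perm ja α
    restrictA-perm = restrict-perm IA Pσ σ-¬P (λ x<n ¬pσx px → ¬pσx (σ-P x<n px))

    glue-restrict : glue′ β α ≈[ n ] σ
    glue-restrict {x} x<n with toSum (P? x)
    ... | inj₁ px = trans (glue-inB β α px) (trans (cong (embB ∘ idxB ∘ σ) (B.emb-idx x<n px))
                      (B.emb-idx (bounded Pσ x<n) (σ-P x<n px)))
    ... | inj₂ ¬px = trans (glue-inA β α ¬px) (trans (cong (embA ∘ idxA ∘ σ) (A.emb-idx x<n ¬px))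
                      (A.emb-idx (bounded Pσ x<n) (σ-¬P x<n ¬px)))

infix 0 if_<_then_else_

if_<_then_else_ : ℕ → ℕ → ℕ → ℕ → ℕ
if x < y then a else b with x <? y
... | yes _ = a
... | no _ = b

if-< : ∀ {x y} a b → x < y → (if x < y then a else b) ≡ a
if-< {x} {y} a b x<y with x <? y
... | yes _ = refl
... | no x≮y = ⊥-elim (x≮y x<y)

if-≮ : ∀ {x y} a b → ¬ x < y → (if x < y then a else b) ≡ b
if-≮ {x} {y} a b x≮y with x <? y
... | yes x<y = ⊥-elim (x≮y x<y)
... | no _ = refl

n≤m<n+o⇒m∸n<o : ∀ {m n o} → n ≤ m → m < n + o → m ∸ n < o
n≤m<n+o⇒m∸n<o {m} {n} {o} n≤m m<n+o = subst (m ∸ n <_) (m+n∸m≡n n o) (∸-monoˡ-< m<n+o n≤m)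

-- In [0, suc (j + k)): the block [g, g + k) ∪ {j + k}, of size suc k, and its complement, of
-- size j, each enumerated increasingly (by blockEmb and by skipBlock, with inverses blockIdx
-- and unskipBlock).
InBlock : ℕ → ℕ → ℕ → ℕ → Set
InBlock g k j x = g ≤ x × (x < g + k ⊎ x ≡ j + k)

InBlock? : ∀ g k j x → Dec (InBlock g k j x)
InBlock? g k j x = (g ≤? x) ×-dec ((x <? g + k) ⊎-dec (x ≟ j + k))

blockEmb : ℕ → ℕ → ℕ → ℕ → ℕ
blockEmb g k j z = if z < k then g + z else j + k

blockIdx : ℕ → ℕ → ℕ → ℕ
blockIdx g k x = if x < g + k then x ∸ g else k

skipBlock : ℕ → ℕ → ℕ → ℕ
skipBlock g k z = if z < g then z else z + k

unskipBlock : ℕ → ℕ → ℕ → ℕ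
unskipBlock g k x = if x < g then x else x ∸ k

module _ {g k j : ℕ} (g<j : g < j) where
  private
    n : ℕ
    n = suc (j + k)
    g+k<j+k : g + k < j + k
    g+k<j+k = +-monoˡ-< k g<j
    top∉[g,g+k⟩ : ¬ j + k < g + k
    top∉[g,g+k⟩ = <⇒≯ g+k<j+k

  blockEmb-< : ∀ {z} → z < suc k → blockEmb g k j z < n
  blockEmb-< {z} _ with toSum (z <? k)
  ... | inj₁ z<k = subst (_< n) (sym (if-< _ _ z<k)) (m<n⇒m<1+n (<-trans (+-monoʳ-< g z<k) g+k<j+k))
  ... | inj₂ z≮k = subst (_< n) (sym (if-≮ _ _ z≮k)) ≤-refl

  blockEmb-∈ : ∀ {z} → z < suc k → InBlock g k j (blockEmb g k j z)
  blockEmb-∈ {z} _ with toSum (z <? k)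
  ... | inj₁ z<k = subst (InBlock g k j) (sym (if-< _ _ z<k)) (m≤m+n g z , inj₁ (+-monoʳ-< g z<k))
  ... | inj₂ z≮k = subst (InBlock g k j) (sym (if-≮ _ _ z≮k)) (≤-trans (<⇒≤ g<j) (m≤m+n j k) , inj₂ refl)

  blockIdx-< : ∀ {x} → x < n → InBlock g k j x → blockIdx g k x < suc k
  blockIdx-< {x} _ (g≤x , _) with toSum (x <? g + k)
  ... | inj₁ x<g+k = subst (_< suc k) (sym (if-< _ _ x<g+k)) (m<n⇒m<1+n (n≤m<n+o⇒m∸n<o g≤x x<g+k))
  ... | inj₂ x≮g+k = subst (_< suc k) (sym (if-≮ _ _ x≮g+k)) ≤-refl

  blockIdx-blockEmb : ∀ {z} → z < suc k → blockIdx g k (blockEmb g k j z) ≡ z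
  blockIdx-blockEmb {z} z<1+k with toSum (z <? k)
  ... | inj₁ z<k = begin
    blockIdx g k (blockEmb g k j z) ≡⟨ cong (blockIdx g k) (if-< _ _ z<k) ⟩
    blockIdx g k (g + z)            ≡⟨ if-< _ _ (+-monoʳ-< g z<k) ⟩
    g + z ∸ g                       ≡⟨ m+n∸m≡n g z ⟩
    z                               ∎
    where open ≡-Reasoning
  ... | inj₂ z≮k = begin
    blockIdx g k (blockEmb g k j z) ≡⟨ cong (blockIdx g k) (if-≮ _ _ z≮k) ⟩
    blockIdx g k (j + k)            ≡⟨ if-≮ _ _ top∉[g,g+k⟩ ⟩
    k                               ≡⟨ ≤-antisym (≮⇒≥ z≮k) (≤-pred z<1+k) ⟩
    z                               ∎
    where open ≡-Reasoning

  blockEmb-blockIdx : ∀ {x} → x < n → InBlock g k j x → blockEmb g k j (blockIdx g k x) ≡ x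
  blockEmb-blockIdx {x} _ (g≤x , inj₁ x<g+k) = begin
    blockEmb g k j (blockIdx g k x) ≡⟨ cong (blockEmb g k j) (if-< _ _ x<g+k) ⟩
    blockEmb g k j (x ∸ g)          ≡⟨ if-< _ _ (n≤m<n+o⇒m∸n<o g≤x x<g+k) ⟩
    g + (x ∸ g)                     ≡⟨ m+[n∸m]≡n g≤x ⟩
    x                               ∎
    where open ≡-Reasoning
  blockEmb-blockIdx {x} _ (g≤x , inj₂ refl) = begin
    blockEmb g k j (blockIdx g k (j + k)) ≡⟨ cong (blockEmb g k j) (if-≮ _ _ top∉[g,g+k⟩) ⟩
    blockEmb g k j k                      ≡⟨ if-≮ {k} _ _ (<-irrefl refl) ⟩
    j + k                                 ∎
    where open ≡-Reasoning

  block-indexing : Indexing (suc k) n (InBlock g k j) (blockEmb g k j) (blockIdx g k)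
  block-indexing = record
    { emb-< = blockEmb-< ; emb-P = blockEmb-∈ ; idx-< = blockIdx-<
    ; idx-emb = blockIdx-blockEmb ; emb-idx = blockEmb-blockIdx }

  skipBlock-< : ∀ {z} → z < j → skipBlock g k z < n
  skipBlock-< {z} z<j with toSum (z <? g)
  ... | inj₁ z<g = subst (_< n) (sym (if-< _ _ z<g)) (m<n⇒m<1+n (<-≤-trans z<j (m≤m+n j k)))
  ... | inj₂ z≮g = subst (_< n) (sym (if-≮ _ _ z≮g)) (m<n⇒m<1+n (+-monoˡ-< k z<j))

  skipBlock-∉ : ∀ {z} → z < j → ¬ InBlock g k j (skipBlock g k z)
  skipBlock-∉ {z} z<j with toSum (z <? g)
  ... | inj₁ z<g = λ (g≤z , _) → <⇒≱ z<g (subst (g ≤_) (if-< _ _ z<g) g≤z)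
  ... | inj₂ z≮g = λ
    { (_ , inj₁ z+k<g+k) → <⇒≱ (subst (_< g + k) (if-≮ _ _ z≮g) z+k<g+k) (+-monoˡ-≤ k (≮⇒≥ z≮g))
    ; (_ , inj₂ z+k≡j+k) → <⇒≢ (+-monoˡ-< k z<j) (trans (sym (if-≮ _ _ z≮g)) z+k≡j+k) }

  private
    beyond-block : ∀ {x} → x < n → ¬ InBlock g k j x → ¬ x < g → g + k ≤ x × x < j + k
    beyond-block x<n x∉ x≮g = ≮⇒≥ (λ x<g+k → x∉ (≮⇒≥ x≮g , inj₁ x<g+k)) ,
                        ≤∧≢⇒< (≤-pred x<n) (λ x≡j+k → x∉ (≮⇒≥ x≮g , inj₂ x≡j+k))

  unskipBlock-< : ∀ {x} → x < n → ¬ InBlock g k j x → unskipBlock g k x < j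
  unskipBlock-< {x} x<n x∉ with toSum (x <? g)
  ... | inj₁ x<g = subst (_< j) (sym (if-< _ _ x<g)) (<-trans x<g g<j)
  ... | inj₂ x≮g = subst (_< j) (sym (if-≮ _ _ x≮g))
                   (n≤m<n+o⇒m∸n<o (≤-trans (m≤n+m k g) g+k≤x) (subst (x <_) (+-comm j k) x<j+k))
    where
      g+k≤x : g + k ≤ x
      g+k≤x = proj₁ (beyond-block x<n x∉ x≮g)
      x<j+k : x < j + k
      x<j+k = proj₂ (beyond-block x<n x∉ x≮g)

  unskipBlock-skipBlock : ∀ {z} → z < j → unskipBlock g k (skipBlock g k z) ≡ z
  unskipBlock-skipBlock {z} _ with toSum (z <? g)
  ... | inj₁ z<g = trans (cong (unskipBlock g k) (if-< _ _ z<g)) (if-< _ _ z<g)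
  ... | inj₂ z≮g = begin
    unskipBlock g k (skipBlock g k z) ≡⟨ cong (unskipBlock g k) (if-≮ _ _ z≮g) ⟩
    unskipBlock g k (z + k)           ≡⟨ if-≮ _ _ (λ z+k<g → z≮g (≤-<-trans (m≤m+n z k) z+k<g)) ⟩
    z + k ∸ k                         ≡⟨ m+n∸n≡m z k ⟩
    z                                 ∎
    where open ≡-Reasoning

  skipBlock-unskipBlock : ∀ {x} → x < n → ¬ InBlock g k j x → skipBlock g k (unskipBlock g k x) ≡ x
  skipBlock-unskipBlock {x} x<n x∉ with toSum (x <? g)
  ... | inj₁ x<g = trans (cong (skipBlock g k) (if-< _ _ x<g)) (if-< _ _ x<g)
  ... | inj₂ x≮g = begin
    skipBlock g k (unskipBlock g k x) ≡⟨ cong (skipBlock g k) (if-≮ _ _ x≮g) ⟩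
    skipBlock g k (x ∸ k)             ≡⟨ if-≮ _ _ (≤⇒≯ g≤x∸k) ⟩
    x ∸ k + k                         ≡⟨ m∸n+n≡m (≤-trans (m≤n+m k g) g+k≤x) ⟩
    x                                 ∎
    where
      open ≡-Reasoning
      g+k≤x : g + k ≤ x
      g+k≤x = proj₁ (beyond-block x<n x∉ x≮g)
      g≤x∸k : g ≤ x ∸ k
      g≤x∸k = m+n≤o⇒m≤o∸n g g+k≤x

  rest-indexing : Indexing j n (¬_ ∘ InBlock g k j) (skipBlock g k) (unskipBlock g k)
  rest-indexing = record
    { emb-< = skipBlock-< ; emb-P = skipBlock-∉ ; idx-< = unskipBlock-<
    ; idx-emb = unskipBlock-skipBlock ; emb-idx = skipBlock-unskipBlock }

module _ {g k : ℕ} where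

  skip-preimage-below : ∀ {j p q} → q ≤ g → g < j → Preimage (skipBlock g k) j p q p q
  skip-preimage-below {j} {p} {q} q≤g g<j = record
    { q′≤j = ≤-trans q≤g (<⇒≤ g<j)
    ; maps = λ _ y∈ → subst (_∈[ p , q ⟩) (sym (if-< _ _ (<-≤-trans (proj₂ y∈) q≤g))) y∈
    ; pulls = pulls }
    where
      pulls : ∀ {y} → y < j → skipBlock g k y ∈[ p , q ⟩ → y ∈[ p , q ⟩
      pulls {y} _ e∈ with toSum (y <? g)
      ... | inj₁ y<g = subst (_∈[ p , q ⟩) (if-< _ _ y<g) e∈
      ... | inj₂ y≮g = ⊥-elim (<⇒≱ (subst (_< q) (if-≮ _ _ y≮g) (proj₂ e∈))
                                  (≤-trans q≤g (≤-trans (≮⇒≥ y≮g) (m≤m+n y k))))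

  skip-preimage-above : ∀ {j p q} → g ≤ p → q ≤ j → Preimage (skipBlock g k) j p q (p + k) (q + k)
  skip-preimage-above {j} {p} {q} g≤p q≤j = record { q′≤j = q≤j ; maps = maps ; pulls = pulls }
    where
      maps : ∀ {y} → y < j → y ∈[ p , q ⟩ → skipBlock g k y ∈[ p + k , q + k ⟩
      maps _ (p≤y , y<q) = subst (_∈[ p + k , q + k ⟩) (sym (if-≮ _ _ (≤⇒≯ (≤-trans g≤p p≤y))))
                           (+-monoˡ-≤ k p≤y , +-monoˡ-< k y<q)
      pulls : ∀ {y} → y < j → skipBlock g k y ∈[ p + k , q + k ⟩ → y ∈[ p , q ⟩
      pulls {y} _ e∈ with toSum (y <? g)
      ... | inj₁ y<g = ⊥-elim (<⇒≱ y<g (≤-trans g≤p (≤-trans (m≤m+n p k)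
                                 (subst (p + k ≤_) (if-< _ _ y<g) (proj₁ e∈)))))
      ... | inj₂ y≮g = let p+k≤y+k , y+k<q+k = subst (_∈[ p + k , q + k ⟩) (if-≮ _ _ y≮g) e∈ in
                       +-cancelʳ-≤ k p y p+k≤y+k , +-cancelʳ-< k y q y+k<q+k

  skip-preimage-across : ∀ {j p q} → p ≤ g → g ≤ q → q ≤ j → Preimage (skipBlock g k) j p q p (q + k)
  skip-preimage-across {j} {p} {q} p≤g g≤q q≤j = record { q′≤j = q≤j ; maps = maps ; pulls = pulls }
    where
      maps : ∀ {y} → y < j → y ∈[ p , q ⟩ → skipBlock g k y ∈[ p , q + k ⟩
      maps {y} _ (p≤y , y<q) with toSum (y <? g)
      ... | inj₁ y<g = subst (_∈[ p , q + k ⟩) (sym (if-< _ _ y<g)) (p≤y , <-≤-trans y<q (m≤m+n q k))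
      ... | inj₂ y≮g = subst (_∈[ p , q + k ⟩) (sym (if-≮ _ _ y≮g)) (≤-trans p≤y (m≤m+n y k) , +-monoˡ-< k y<q)
      pulls : ∀ {y} → y < j → skipBlock g k y ∈[ p , q + k ⟩ → y ∈[ p , q ⟩
      pulls {y} _ e∈ with toSum (y <? g)
      ... | inj₁ y<g = proj₁ (subst (_∈[ p , q + k ⟩) (if-< _ _ y<g) e∈) , <-≤-trans y<g g≤q
      ... | inj₂ y≮g = ≤-trans p≤g (≮⇒≥ y≮g) ,
                       +-cancelʳ-< k y q (proj₂ (subst (_∈[ p , q + k ⟩) (if-≮ _ _ y≮g) e∈))

  block-preimage-inside : ∀ {j p q} → g < j → q ≤ k → Preimage (blockEmb g k j) (suc k) p q (g + p) (g + q)
  block-preimage-inside {j} {p} {q} g<j q≤k = record { q′≤j = m≤n⇒m≤1+n q≤k ; maps = maps ; pulls = pulls }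
    where
      maps : ∀ {y} → y < suc k → y ∈[ p , q ⟩ → blockEmb g k j y ∈[ g + p , g + q ⟩
      maps _ (p≤y , y<q) = subst (_∈[ g + p , g + q ⟩) (sym (if-< _ _ (<-≤-trans y<q q≤k)))
                           (+-monoʳ-≤ g p≤y , +-monoʳ-< g y<q)
      pulls : ∀ {y} → y < suc k → blockEmb g k j y ∈[ g + p , g + q ⟩ → y ∈[ p , q ⟩
      pulls {y} _ e∈ with toSum (y <? k)
      ... | inj₁ y<k = let g+p≤g+y , g+y<g+q = subst (_∈[ g + p , g + q ⟩) (if-< _ _ y<k) e∈ in
                       +-cancelˡ-≤ g p y g+p≤g+y , +-cancelˡ-< g y q g+y<g+q
      ... | inj₂ y≮k = ⊥-elim (<⇒≱ (subst (_< g + q) (if-≮ _ _ y≮k) (proj₂ e∈))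
                                  (≤-trans (+-monoʳ-≤ g q≤k) (<⇒≤ (+-monoˡ-< k g<j))))

  block-preimage-meet : ∀ {j p q} → g ≤ q → q ≤ j + k →
                      Preimage (blockEmb g k j) (suc k) (p ∸ g) ((q ∸ g) ⊓ k) p q
  block-preimage-meet {j} {p} {q} g≤q q≤j+k = record
    { q′≤j = m≤n⇒m≤1+n (m⊓n≤n (q ∸ g) k) ; maps = maps ; pulls = pulls }
    where
      maps : ∀ {y} → y < suc k → y ∈[ p ∸ g , (q ∸ g) ⊓ k ⟩ → blockEmb g k j y ∈[ p , q ⟩
      maps {y} _ (p∸g≤y , y<min) = subst (_∈[ p , q ⟩) (sym (if-< _ _ (<-≤-trans y<min (m⊓n≤n (q ∸ g) k))))
        (≤-trans (m≤n+m∸n p g) (+-monoʳ-≤ g p∸g≤y) ,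
         subst (_≤ q) (+-suc g y) (subst (_≤ q) (+-comm (suc y) g)
           (m≤o∸n⇒m+n≤o (suc y) g≤q (<-≤-trans y<min (m⊓n≤m (q ∸ g) k)))))
      pulls : ∀ {y} → y < suc k → blockEmb g k j y ∈[ p , q ⟩ → y ∈[ p ∸ g , (q ∸ g) ⊓ k ⟩
      pulls {y} _ e∈ with toSum (y <? k)
      ... | inj₁ y<k = let p≤g+y , g+y<q = subst (_∈[ p , q ⟩) (if-< _ _ y<k) e∈ in
        m≤n+o⇒m∸n≤o p g p≤g+y ,
        ⊓-pres-m< (m+n≤o⇒m≤o∸n (suc y) (subst (_≤ q) (trans (sym (+-suc g y)) (+-comm g (suc y))) g+y<q)) y<k
      ... | inj₂ y≮k = ⊥-elim (<⇒≱ (subst (_< q) (if-≮ _ _ y≮k) (proj₂ e∈)) q≤j+k)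

module _ {g k j : ℕ} where

  top∈block : g ≤ j → InBlock g k j (j + k)
  top∈block g≤j = ≤-trans g≤j (m≤m+n j k) , inj₂ refl

  [g,g+k⟩⊆block : ∀ {x} → x ∈[ g , g + k ⟩ → InBlock g k j x
  [g,g+k⟩⊆block (g≤x , x<g+k) = g≤x , inj₁ x<g+k

  block-below-top : ∀ {x} → InBlock g k j x → x < j + k → x ∈[ g , g + k ⟩
  block-below-top (g≤x , inj₁ x<g+k) _ = g≤x , x<g+k
  block-below-top (_ , inj₂ refl) x<j+k = ⊥-elim (<-irrefl refl x<j+k)

  ∉block : ∀ {x} → x < j + k → ¬ x ∈[ g , g + k ⟩ → ¬ InBlock g k j x
  ∉block x<j+k x∉ x∈ = x∉ (block-below-top x∈ x<j+k)

  ∉block⇒skip : g < j → ∀ {x} → x < j + k → ¬ x ∈[ g , g + k ⟩ →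
                ∃ λ y → y < j × skipBlock g k y ≡ x
  ∉block⇒skip g<j {x} x<j+k x∉ = unskipBlock g k x , unskipBlock-< g<j (m<n⇒m<1+n x<j+k) (∉block x<j+k x∉) ,
                                   skipBlock-unskipBlock g<j (m<n⇒m<1+n x<j+k) (∉block x<j+k x∉)

compose : ℕ → ℕ → ℕ → (ℕ → ℕ) → (ℕ → ℕ) → ℕ → ℕ
compose g k j = glue (InBlock? g k j) (blockEmb g k j) (blockIdx g k) (skipBlock g k) (unskipBlock g k)

module Composition {g k j : ℕ} (0<g : 0 < g) (g<j : g < j) (0<k : 0 < k)
                   {β α : ℕ → ℕ} (Pβ : Perm (suc k) β) (Hβ : SIF (suc k) β) (Pα : Perm j α) (Hα : SIF j α) where
  private
    m : ℕ
    m = j + k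
    g+k<m : g + k < m
    g+k<m = +-monoˡ-< k g<j
    g+k≤m : g + k ≤ m
    g+k≤m = <⇒≤ g+k<m
    module B = Indexing (block-indexing {g} {k} {j} g<j)
    module A = Indexing (rest-indexing {g} {k} {j} g<j)
  open Gluing (InBlock? g k j) (block-indexing g<j) (rest-indexing g<j)

  σ : ℕ → ℕ
  σ = compose g k j β α

  τ : ℕ → ℕ
  τ = remove m σ

  compose-perm : Perm (suc m) σ
  compose-perm = glue-perm Pβ Pα

  private
    Pτ : Perm m τ
    Pτ = remove-perm compose-perm

    σ-skip : ∀ {y} → y < j → σ (skipBlock g k y) ≡ skipBlock g k (α y)
    σ-skip = glue-embA β α

    τ-skip : ∀ {y} → y < j → τ (skipBlock g k y) ≡ skipBlock g k (α y)
    τ-skip {y} y<j = trans (remove-miss m σ σ-skip≢m) (σ-skip y<j)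
      where
        σ-skip≢m : σ (skipBlock g k y) ≢ m
        σ-skip≢m σ≡m = A.emb-P (bounded Pα y<j)
          (subst (InBlock g k j) (trans (sym σ≡m) (σ-skip y<j)) (top∈block (<⇒≤ g<j)))

    α-stab-off-block : ∀ {f p′ q′ p q} → (∀ {y} → y < j → f (skipBlock g k y) ≡ skipBlock g k (α y)) →
      Preimage (skipBlock g k) j p′ q′ p q → (∀ {x} → x ∈[ p , q ⟩ → x < m × ¬ x ∈[ g , g + k ⟩) →
      Stab f p q → Stab α p′ q′
    α-stab-off-block commute W off = stab-pullback W commute Pα A.emb-injective
      (λ x∈ _ _ → ∉block⇒skip g<j (proj₁ (off x∈)) (proj₂ (off x∈)))

    no-stab-off-block : ∀ {f p q} → (∀ {y} → y < j → f (skipBlock g k y) ≡ skipBlock g k (α y)) →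
      p < q → q ≤ m → q ≤ g ⊎ g + k ≤ p → ¬ Stab f p q
    no-stab-off-block {f} {p} {q} commute p<q q≤m (inj₁ q≤g) S =
      <⇒≢ (≤-<-trans q≤g g<j) (proj₂ (Hα p<q (≤-trans q≤g (<⇒≤ g<j)) Sα))
      where
        Sα : Stab α p q
        Sα = α-stab-off-block commute (skip-preimage-below q≤g g<j)
               (λ (_ , x<q) → <-≤-trans x<q q≤m , λ (g≤x , _) → <⇒≱ (<-≤-trans x<q q≤g) g≤x) S
    no-stab-off-block {f} {p} {q} commute p<q q≤m (inj₂ g+k≤p) S =
      <⇒≢ (<-≤-trans 0<g g≤p′) (sym (proj₁ (Hα (∸-monoˡ-< p<q k≤p) (m≤n+o⇒m∸n≤o q k (subst (q ≤_) (+-comm j k) q≤m)) Sα)))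
      where
        k≤p : k ≤ p
        k≤p = ≤-trans (m≤n+m k g) g+k≤p
        g≤p′ : g ≤ p ∸ k
        g≤p′ = m+n≤o⇒m≤o∸n g g+k≤p
        Sα : Stab α (p ∸ k) (q ∸ k)
        Sα = α-stab-off-block commute
               (subst₂ (Preimage (skipBlock g k) j (p ∸ k) (q ∸ k)) (m∸n+n≡m k≤p) (m∸n+n≡m (≤-trans k≤p (<⇒≤ p<q)))
                 (skip-preimage-above g≤p′ (m≤n+o⇒m∸n≤o q k (subst (q ≤_) (+-comm j k) q≤m))))
               (λ (p≤x , x<q) → <-≤-trans x<q q≤m , λ (_ , x<g+k) → <⇒≱ x<g+k (≤-trans g+k≤p p≤x)) S

  compose-SIF : SIF (suc m) σ
  compose-SIF = SIF-intro compose-perm none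
    where
      none : ∀ {p q} → p < q → q < suc m → ¬ Stab σ p q
      none {p} {q} p<q q<1+m S with q ≤? g | g + k ≤? p
      ... | yes q≤g | _ = no-stab-off-block σ-skip p<q (≤-pred q<1+m) (inj₁ q≤g) S
      ... | no _ | yes g+k≤p = no-stab-off-block σ-skip p<q (≤-pred q<1+m) (inj₂ g+k≤p) S
      -- [p, q) meets [g, g + k) without containing the top, so β stabilizes the overlap.
      ... | no q≰g | no g+k≰p = <⇒≢ (s≤s (m⊓n≤n (q ∸ g) k)) (proj₂ (Hβ p′<q′ (m≤n⇒m≤1+n (m⊓n≤n (q ∸ g) k)) Sβ))
        where
          g<q : g < q
          g<q = ≰⇒> q≰g
          p<g+k : p < g + k
          p<g+k = ≰⇒> g+k≰p
          p′<q′ : p ∸ g < (q ∸ g) ⊓ k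
          p′<q′ with g ≤? p
          ... | yes g≤p = ⊓-pres-m< (∸-monoˡ-< p<q g≤p) (n≤m<n+o⇒m∸n<o g≤p p<g+k)
          ... | no g≰p = subst (_< (q ∸ g) ⊓ k) (sym (m≤n⇒m∸n≡0 (<⇒≤ (≰⇒> g≰p)))) (⊓-pres-m< (m<n⇒0<n∸m g<q) 0<k)
          closed : ∀ {x z} → x ∈[ p , q ⟩ → z < suc k → σ x ≡ blockEmb g k j z →
                   ∃ λ y → y < suc k × blockEmb g k j y ≡ x
          closed {x} x∈ z<1+k σx≡ with toSum (InBlock? g k j x)
          ... | inj₁ x∈B = blockIdx g k x , B.idx-< x<1+m x∈B , B.emb-idx x<1+m x∈B
            where
              x<1+m : x < suc m
              x<1+m = <-trans (proj₂ x∈) q<1+m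
          ... | inj₂ x∉B = ⊥-elim (glue-preserves-¬P Pβ Pα (<-trans (proj₂ x∈) q<1+m) x∉B
                                   (subst (InBlock g k j) (sym σx≡) (B.emb-P z<1+k)))
          Sβ : Stab β (p ∸ g) ((q ∸ g) ⊓ k)
          Sβ = stab-pullback (block-preimage-meet (<⇒≤ g<q) (≤-pred q<1+m)) (glue-embB β α) Pβ B.emb-injective closed S

  remove-stab-block : Stab τ g (g + k)
  remove-stab-block = stab-intro Pτ g+k≤m into′ compl
    where
      τ-block : ∀ {x} → x < m → InBlock g k j x → InBlock g k j (τ x)
      τ-block {x} x<m x∈B with toSum (σ x ≟ m)
      ... | inj₁ σx≡m = subst (InBlock g k j) (sym (remove-hit m σ σx≡m))
                         (glue-preserves-P Pβ Pα ≤-refl (top∈block (<⇒≤ g<j)))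
      ... | inj₂ σx≢m = subst (InBlock g k j) (sym (remove-miss m σ σx≢m))
                         (glue-preserves-P Pβ Pα (m<n⇒m<1+n x<m) x∈B)
      into′ : ∀ {x} → x ∈[ g , g + k ⟩ → τ x ∈[ g , g + k ⟩
      into′ {x} x∈ = block-below-top (τ-block x<m ([g,g+k⟩⊆block x∈)) (bounded Pτ x<m)
        where
          x<m : x < m
          x<m = <-≤-trans (proj₂ x∈) g+k≤m
      compl : ∀ {x} → x < m → ¬ x ∈[ g , g + k ⟩ → ¬ τ x ∈[ g , g + k ⟩
      compl {x} x<m x∉ τx∈ = σx∉B (subst (InBlock g k j) (remove-miss m σ σx≢m) ([g,g+k⟩⊆block τx∈))
        where
          σx∉B : ¬ InBlock g k j (σ x)
          σx∉B = glue-preserves-¬P Pβ Pα (m<n⇒m<1+n x<m) (∉block x<m x∉)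
          σx≢m : σ x ≢ m
          σx≢m σx≡m = σx∉B (subst (InBlock g k j) (sym σx≡m) (top∈block (<⇒≤ g<j)))

  private
    -- Cutting the block out of an interval around it leaves an α-stabilized interval.
    stab-around-block : ∀ {p q} → Stab τ p q → p ≤ g → g + k ≤ q → q ≤ m → p < g ⊎ g + k < q → Whole m p q
    stab-around-block {p} {q} S p≤g g+k≤q q≤m strict = proj₁ whole , trans (sym (m∸n+n≡m k≤q)) (cong (_+ k) (proj₂ whole))
      where
        k≤q : k ≤ q
        k≤q = ≤-trans (m≤n+m k g) g+k≤q
        g≤q′ : g ≤ q ∸ k
        g≤q′ = m+n≤o⇒m≤o∸n g g+k≤q
        q′≤j : q ∸ k ≤ j
        q′≤j = m≤n+o⇒m∸n≤o q k (subst (q ≤_) (+-comm j k) q≤m)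
        p<q′ : p < q ∸ k
        p<q′ = from strict
          where
            from : p < g ⊎ g + k < q → p < q ∸ k
            from (inj₁ p<g) = <-≤-trans p<g g≤q′
            from (inj₂ g+k<q) = ≤-<-trans p≤g (m+n≤o⇒m≤o∸n (suc g) g+k<q)
        closed : ∀ {x z} → x ∈[ p , q ⟩ → z < j → τ x ≡ skipBlock g k z → ∃ λ y → y < j × skipBlock g k y ≡ x
        closed {x} x∈ z<j τx≡ with x ∈[ g , g + k ⟩?
        ... | yes x∈K = ⊥-elim (A.emb-P z<j (subst (InBlock g k j) τx≡ ([g,g+k⟩⊆block (into remove-stab-block x∈K))))
        ... | no x∉K = ∉block⇒skip g<j (<-≤-trans (proj₂ x∈) q≤m) x∉K
        whole : Whole j p (q ∸ k)
        whole = Hα p<q′ q′≤j (stab-pullback (subst (Preimage (skipBlock g k) j p (q ∸ k) p) (m∸n+n≡m k≤q)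
                                               (skip-preimage-across p≤g g≤q′ q′≤j))
                                             τ-skip Pα A.emb-injective closed S)

  -- An interval not inside [g, g + k) either avoids the block, and α would stabilize it, or
  -- joined with [g, g + k) it gives a stabilized interval around the block.
  stab-within-block : ∀ {p q} → ProperStab m τ p q → g ≤ p × q ≤ g + k
  stab-within-block {p} {q} (p<q , q≤m , proper , S) with g ≤? p | q ≤? g + k
  ... | yes g≤p | yes q≤g+k = g≤p , q≤g+k
  ... | yes g≤p | no q≰g+k with g + k ≤? p
  ...   | yes g+k≤p = ⊥-elim (no-stab-off-block τ-skip p<q q≤m (inj₂ g+k≤p) S)
  ...   | no g+k≰p = ⊥-elim (<⇒≢ 0<g (sym (proj₁ (stab-around-block
            (stab-∪ remove-stab-block S g≤p (<⇒≤ (≰⇒> g+k≰p)) (<⇒≤ (≰⇒> q≰g+k))) ≤-refl (<⇒≤ (≰⇒> q≰g+k)) q≤m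
            (inj₂ (≰⇒> q≰g+k))))))
  stab-within-block {p} {q} (p<q , q≤m , proper , S) | no g≰p | _ with q ≤? g | q ≤? g + k
  ... | yes q≤g | _ = ⊥-elim (no-stab-off-block τ-skip p<q q≤m (inj₁ q≤g) S)
  ... | no q≰g | yes q≤g+k = ⊥-elim (<⇒≢ g+k<m (proj₂ (stab-around-block
            (stab-∪ S remove-stab-block (<⇒≤ (≰⇒> g≰p)) (<⇒≤ (≰⇒> q≰g)) q≤g+k) (<⇒≤ (≰⇒> g≰p)) ≤-refl g+k≤m
            (inj₁ (≰⇒> g≰p)))))
  ... | no _ | no q≰g+k = ⊥-elim (proper (stab-around-block S (<⇒≤ (≰⇒> g≰p)) (<⇒≤ (≰⇒> q≰g+k)) q≤m (inj₁ (≰⇒> g≰p))))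

module Decomposition {g k j : ℕ} {σ : ℕ → ℕ} (Pσ : Perm (suc (j + k)) σ) (Hσ : SIF (suc (j + k)) σ)
                     {i : ℕ} (i<1+m : i < suc (j + k)) (σi≡m : σ i ≡ j + k)
                     (K : ProperStab (j + k) (remove (j + k) σ) g (g + k))
                     (leftmost : ∀ {p q} → p ≤ g → g + k ≤ q →
                                 ProperStab (j + k) (remove (j + k) σ) p q → p ≡ g) where
  private
    m : ℕ
    m = j + k
    τ : ℕ → ℕ
    τ = remove m σ
    Pτ : Perm m τ
    Pτ = remove-perm Pσ
    g<g+k : g < g + k
    g<g+k = proj₁ K
    g+k≤m : g + k ≤ m
    g+k≤m = proj₁ (proj₂ K)
    SK : Stab τ g (g + k)
    SK = proj₂ (proj₂ (proj₂ K))
    i∈K : i ∈[ g , g + k ⟩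
    i∈K = remove-stab-∋ Pσ Hσ i<1+m σi≡m g<g+k g+k≤m SK

  0<k : 0 < k
  0<k = +-cancelˡ-< g 0 k (subst (_< g + k) (sym (+-identityʳ g)) g<g+k)

  -- The preimage i of the top lies in [g, g + k); were [g, g + k) an initial or final
  -- segment of [0, m), its complement would be stabilized too and would have to contain i.
  0<g : 0 < g
  0<g with g ≟ 0
  ... | no g≢0 = n≢0⇒n>0 g≢0
  ... | yes refl = ⊥-elim (<⇒≱ (proj₂ i∈K) (proj₁ (remove-stab-∋ Pσ Hσ i<1+m σi≡m k<m ≤-refl
                     (stab-prefix⇒suffix Pτ g+k≤m SK))))
    where
      k<m : k < m
      k<m = ≤∧≢⇒< g+k≤m (λ k≡m → proj₁ (proj₂ (proj₂ K)) (refl , k≡m))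

  g+k<m : g + k < m
  g+k<m = ≤∧≢⇒< g+k≤m g+k≢m
    where
      g+k≢m : g + k ≢ m
      g+k≢m g+k≡m = <⇒≱ (proj₂ (remove-stab-∋ Pσ Hσ i<1+m σi≡m 0<g (<⇒≤ (<-≤-trans g<g+k g+k≤m))
                      (stab-suffix⇒prefix Pτ (<⇒≤ (<-≤-trans g<g+k g+k≤m)) (subst (Stab τ g) g+k≡m SK))))
                      (proj₁ i∈K)

  g<j : g < j
  g<j = +-cancelʳ-< k g j g+k<m

  private
    module B = Indexing (block-indexing {g} {k} {j} g<j)
    module A = Indexing (rest-indexing {g} {k} {j} g<j)
    top∈B : InBlock g k j m
    top∈B = top∈block (<⇒≤ g<j)

    σ≢m : ∀ {x} → x < suc m → x ≢ i → σ x ≢ m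
    σ≢m x<1+m x≢i σx≡m = x≢i (injective Pσ x<1+m i<1+m (trans σx≡m (sym σi≡m)))

    σ-block : ∀ {x} → x < suc m → InBlock g k j x → InBlock g k j (σ x)
    σ-block {x} x<1+m (g≤x , inj₁ x<g+k) with toSum (x ≟ i)
    ... | inj₁ refl = subst (InBlock g k j) (sym σi≡m) top∈B
    ... | inj₂ x≢i = subst (InBlock g k j) (remove-miss m σ (σ≢m x<1+m x≢i)) ([g,g+k⟩⊆block (into SK (g≤x , x<g+k)))
    σ-block {x} x<1+m (g≤x , inj₂ refl) = subst (InBlock g k j) (remove-hit m σ σi≡m) ([g,g+k⟩⊆block (into SK i∈K))

    σ-off-block : ∀ {x} → x < suc m → ¬ InBlock g k j x → ¬ InBlock g k j (σ x)
    σ-off-block {x} x<1+m x∉B σx∈B =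
      stab-compl Pτ SK g+k≤m x<m x∉K (subst (_∈[ g , g + k ⟩) (sym (remove-miss m σ σx≢m)) (block-below-top σx∈B σx<m))
      where
        x<m : x < m
        x<m = m<1+n∧m≢n⇒m<n x<1+m (λ x≡m → x∉B (subst (InBlock g k j) (sym x≡m) top∈B))
        x∉K : ¬ x ∈[ g , g + k ⟩
        x∉K x∈K = x∉B ([g,g+k⟩⊆block x∈K)
        σx≢m : σ x ≢ m
        σx≢m = σ≢m x<1+m (λ x≡i → x∉K (subst (_∈[ g , g + k ⟩) (sym x≡i) i∈K))
        σx<m : σ x < m
        σx<m = m<1+n∧m≢n⇒m<n (bounded Pσ x<1+m) σx≢m

    open Gluing (InBlock? g k j) (block-indexing g<j) (rest-indexing g<j)

  β : ℕ → ℕ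
  β = restrict (blockEmb g k j) (blockIdx g k) σ

  α : ℕ → ℕ
  α = restrict (skipBlock g k) (unskipBlock g k) σ

  β-perm : Perm (suc k) β
  β-perm = restrictB-perm Pσ σ-block σ-off-block

  α-perm : Perm j α
  α-perm = restrictA-perm Pσ σ-block σ-off-block

  compose-restrict : compose g k j β α ≈[ suc m ] σ
  compose-restrict = glue-restrict Pσ σ-block σ-off-block

  private
    σ-skip : ∀ {y} → y < j → σ (skipBlock g k y) ≡ skipBlock g k (α y)
    σ-skip = σ-embA Pσ σ-block σ-off-block

    σ-blockEmb : ∀ {y} → y < suc k → σ (blockEmb g k j y) ≡ blockEmb g k j (β y)
    σ-blockEmb = σ-embB Pσ σ-block σ-off-block

  β-SIF : SIF (suc k) β
  β-SIF = SIF-intro β-perm none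
    where
      none : ∀ {p q} → p < q → q < suc k → ¬ Stab β p q
      none {p} {q} p<q q<1+k S = <⇒≢ 0<g (sym (m+n≡0⇒m≡0 g (proj₁ (Hσ (+-monoʳ-< g p<q) g+q≤1+m Sσ))))
        where
          q≤k : q ≤ k
          q≤k = ≤-pred q<1+k
          g+q≤1+m : g + q ≤ suc m
          g+q≤1+m = m≤n⇒m≤1+n (≤-trans (+-monoʳ-≤ g q≤k) g+k≤m)
          covers : ∀ {x} → x ∈[ g + p , g + q ⟩ → ∃ λ y → y < suc k × blockEmb g k j y ≡ x
          covers {x} (g+p≤x , x<g+q) = x ∸ g , m<n⇒m<1+n x∸g<k , trans (if-< _ _ x∸g<k) (m+[n∸m]≡n g≤x)
            where
              g≤x : g ≤ x
              g≤x = ≤-trans (m≤m+n g p) g+p≤x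
              x∸g<k : x ∸ g < k
              x∸g<k = n≤m<n+o⇒m∸n<o g≤x (<-≤-trans x<g+q (+-monoʳ-≤ g q≤k))
          Sσ : Stab σ (g + p) (g + q)
          Sσ = stab-pushforward (block-preimage-inside g<j q≤k) σ-blockEmb covers S

  private
    τ-skip : ∀ {y} → y < j → τ (skipBlock g k y) ≡ skipBlock g k (α y)
    τ-skip {y} y<j = trans (remove-miss m σ (σ≢m (A.emb-< y<j) skip≢i)) (σ-skip y<j)
      where
        skip≢i : skipBlock g k y ≢ i
        skip≢i skip≡i = A.emb-P y<j (subst (InBlock g k j) (sym skip≡i) ([g,g+k⟩⊆block i∈K))

    -- [p, q + k) is [p, q) with the block [g, g + k) inserted: stabilized by τ when [p, q) is by α.
    straddle : ∀ {p q} → p ≤ g → g ≤ q → q ≤ j → Stab α p q → Stab τ p (q + k)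
    straddle {p} {q} p≤g g≤q q≤j S = stab-intro Pτ q+k≤m into′ compl
      where
        open Preimage (skip-preimage-across {g} {k} p≤g g≤q q≤j)
        q+k≤m : q + k ≤ m
        q+k≤m = +-monoˡ-≤ k q≤j
        K⊆ : ∀ {x} → x ∈[ g , g + k ⟩ → x ∈[ p , q + k ⟩
        K⊆ (g≤x , x<g+k) = ≤-trans p≤g g≤x , <-≤-trans x<g+k (+-monoˡ-≤ k g≤q)
        into′ : ∀ {x} → x ∈[ p , q + k ⟩ → τ x ∈[ p , q + k ⟩
        into′ {x} x∈ with x ∈[ g , g + k ⟩?
        ... | yes x∈K = K⊆ (into SK x∈K)
        ... | no x∉K with ∉block⇒skip g<j (<-≤-trans (proj₂ x∈) q+k≤m) x∉K
        ...   | y , y<j , refl = subst (_∈[ p , q + k ⟩) (sym (τ-skip y<j))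
                                   (maps (bounded α-perm y<j) (into S (pulls y<j x∈)))
        compl : ∀ {x} → x < m → ¬ x ∈[ p , q + k ⟩ → ¬ τ x ∈[ p , q + k ⟩
        compl {x} x<m x∉ τx∈ with x ∈[ g , g + k ⟩?
        ... | yes x∈K = x∉ (K⊆ x∈K)
        ... | no x∉K with ∉block⇒skip g<j x<m x∉K
        ...   | y , y<j , refl = stab-compl α-perm S q≤j y<j (λ y∈ → x∉ (maps y<j y∈))
                                   (pulls (bounded α-perm y<j) (subst (_∈[ p , q + k ⟩) (τ-skip y<j) τx∈))

    off-K : ∀ {p q x} → q ≤ g ⊎ g + k ≤ p → x ∈[ p , q ⟩ → ¬ x ∈[ g , g + k ⟩
    off-K (inj₁ q≤g) (_ , x<q) (g≤x , _) = <⇒≱ (<-≤-trans x<q q≤g) g≤x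
    off-K (inj₂ g+k≤p) (p≤x , _) (_ , x<g+k) = <⇒≱ x<g+k (≤-trans g+k≤p p≤x)

  α-SIF : SIF j α
  α-SIF {p} {q} p<q q≤j S with q ≤? g | g ≤? p
  ... | yes q≤g | _ = ⊥-elim (<⇒≢ (≤-<-trans q≤g (<-≤-trans g<j (m≤n⇒m≤1+n (m≤m+n j k)))) (proj₂ (Hσ p<q q≤1+m Sσ)))
    where
      q≤1+m : q ≤ suc m
      q≤1+m = m≤n⇒m≤1+n (≤-trans q≤j (m≤m+n j k))
      Sσ : Stab σ p q
      Sσ = stab-pushforward (skip-preimage-below q≤g g<j) σ-skip
             (λ x∈ → ∉block⇒skip g<j (<-≤-trans (proj₂ x∈) (≤-trans q≤j (m≤m+n j k))) (off-K (inj₁ q≤g) x∈)) S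
  ... | no _ | yes g≤p = ⊥-elim (<⇒≢ 0<k (sym (m+n≡0⇒n≡0 p (proj₁ (Hσ (+-monoˡ-< k p<q) q+k≤1+m Sσ)))))
    where
      q+k≤1+m : q + k ≤ suc m
      q+k≤1+m = m≤n⇒m≤1+n (+-monoˡ-≤ k q≤j)
      Sσ : Stab σ (p + k) (q + k)
      Sσ = stab-pushforward (skip-preimage-above g≤p q≤j) σ-skip
             (λ x∈ → ∉block⇒skip g<j (<-≤-trans (proj₂ x∈) (+-monoˡ-≤ k q≤j))
                       (off-K (inj₂ (+-monoˡ-≤ k g≤p)) x∈)) S
  ... | no q≰g | no g≰p with (p ≟ 0) ×-dec (q ≟ j)
  ...   | yes whole = whole
  ...   | no proper = ⊥-elim (<⇒≢ p<g (leftmost (<⇒≤ p<g) (+-monoˡ-≤ k (<⇒≤ g<q))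
                        (<-≤-trans p<q (m≤m+n q k) , +-monoˡ-≤ k q≤j , proper′ ,
                         straddle (<⇒≤ p<g) (<⇒≤ g<q) q≤j S)))
    where
      p<g : p < g
      p<g = ≰⇒> g≰p
      g<q : g < q
      g<q = ≰⇒> q≰g
      proper′ : ¬ Whole m p (q + k)
      proper′ (p≡0 , q+k≡m) = proper (p≡0 , +-cancelʳ-≡ k q j q+k≡m)

stab? : ∀ f p q → Dec (Stab f p q)
stab? f p q = map′ fromBounded toBounded
  (allUpTo? (λ x → (p ≤? x) →-dec (f x ∈[ p , q ⟩?)) q ×-dec
   allUpTo? (λ y → (p ≤? y) →-dec anyUpTo? (λ x → (p ≤? x) ×-dec (f x ≟ y)) q) q)
  where
    StabByBounds : Set
    StabByBounds = (∀ {x} → x < q → p ≤ x → f x ∈[ p , q ⟩) ×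
                   (∀ {y} → y < q → p ≤ y → ∃ λ x → x < q × (p ≤ x × f x ≡ y))
    fromBounded : StabByBounds → Stab f p q
    fromBounded (into′ , onto′) = record
      { into = λ (p≤x , x<q) → into′ x<q p≤x
      ; onto = λ (p≤y , y<q) → let x , x<q , p≤x , fx≡y = onto′ y<q p≤y in x , (p≤x , x<q) , fx≡y }
    toBounded : Stab f p q → StabByBounds
    toBounded S = (λ x<q p≤x → into S (p≤x , x<q)) ,
                  (λ y<q p≤y → let x , (p≤x , x<q) , fx≡y = onto S (p≤y , y<q) in x , x<q , p≤x , fx≡y)

properStab? : ∀ n f p q → Dec (ProperStab n f p q)
properStab? n f p q = (p <? q) ×-dec (q ≤? n) ×-dec ¬? ((p ≟ 0) ×-dec (q ≟ n)) ×-dec stab? f p q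

module _ {P : ℕ → Set} (P? : ∀ s → Dec (P s)) where

  largest : ∀ B {s₀} → P s₀ → s₀ ≤ B → ∃ λ s → P s × (∀ {s′} → P s′ → s′ ≤ B → s′ ≤ s)
  largest zero ps₀ z≤n = 0 , ps₀ , λ _ s′≤0 → s′≤0
  largest (suc B) ps₀ s₀≤1+B with P? (suc B)
  ... | yes pB = suc B , pB , λ _ s′≤1+B → s′≤1+B
  ... | no ¬pB with largest B ps₀ (≤B ps₀ s₀≤1+B)
    where
      ≤B : ∀ {s} → P s → s ≤ suc B → s ≤ B
      ≤B ps s≤1+B = ≤-pred (≤∧≢⇒< s≤1+B (λ { refl → ¬pB ps }))
  ...   | s , ps , max = s , ps , λ ps′ s′≤1+B → max ps′ (≤-pred (≤∧≢⇒< s′≤1+B (λ { refl → ¬pB ps′ })))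

-- Take an R-interval [g, g + k) of maximal length: an R-interval [p, q) ⊇ [g, g + k) has
-- length at most k, which forces p = g.
module _ {R : ℕ → ℕ → Set} (R? : ∀ p q → Dec (R p q)) {m : ℕ} (bounds : ∀ {p q} → R p q → p ≤ q × q ≤ m) where

  longest : ∀ {p₀ q₀} → R p₀ q₀ →
            ∃ λ g → ∃ λ k → R g (g + k) × (∀ {p q} → p ≤ g → g + k ≤ q → R p q → p ≡ g)
  longest {p₀} {q₀} R₀ with largest (λ s → anyUpTo? (λ p → R? p (p + s)) (suc m)) m
                                     (p₀ , s≤s (≤-trans p₀≤q₀ q₀≤m) , R-length R₀)
                                     (≤-trans (m∸n≤m q₀ p₀) q₀≤m)
    where
      p₀≤q₀ : p₀ ≤ q₀
      p₀≤q₀ = proj₁ (bounds R₀)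
      q₀≤m : q₀ ≤ m
      q₀≤m = proj₂ (bounds R₀)
      R-length : ∀ {p q} → R p q → R p (p + (q ∸ p))
      R-length {p} Rpq = subst (R p) (sym (m+[n∸m]≡n (proj₁ (bounds Rpq)))) Rpq
  ... | k , (g , _ , Rg) , max = g , k , Rg , leftmost
    where
      leftmost : ∀ {p q} → p ≤ g → g + k ≤ q → R p q → p ≡ g
      leftmost {p} {q} p≤g g+k≤q Rpq = ≤-antisym p≤g (+-cancelʳ-≤ k g p (begin
        g + k         ≤⟨ g+k≤q ⟩
        q             ≡⟨ m+[n∸m]≡n p≤q ⟨
        p + (q ∸ p)   ≤⟨ +-monoʳ-≤ p (max (p , s≤s (≤-trans p≤q q≤m) , subst (R p) (sym (m+[n∸m]≡n p≤q)) Rpq)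
                                          (≤-trans (m∸n≤m q p) q≤m)) ⟩
        p + k         ∎))
        where
          open ≤-Reasoning
          p≤q : p ≤ q
          p≤q = proj₁ (bounds Rpq)
          q≤m : q ≤ m
          q≤m = proj₂ (bounds Rpq)

record Splitting (m : ℕ) : Set where
  constructor splitting
  field
    j g k : ℕ
    β α : ℕ → ℕ
    0<g : 0 < g
    g<j : g < j
    0<k : 0 < k
    j+k≡m : j + k ≡ m
    β-perm : Perm (suc k) β
    β-SIF : SIF (suc k) β
    α-perm : Perm j α
    α-SIF : SIF j α

  permutation : ℕ → ℕ
  permutation = compose g k j β α

open Splitting using (permutation)

module _ {m : ℕ} where

  splitting-perm : (c : Splitting m) → Perm (suc m) (permutation c)
  splitting-perm (splitting j g k β α 0<g g<j 0<k refl Pβ Hβ Pα Hα) = Composition.compose-perm 0<g g<j 0<k Pβ Hβ Pα Hα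

  splitting-SIF : (c : Splitting m) → SIF (suc m) (permutation c)
  splitting-SIF (splitting j g k β α 0<g g<j 0<k refl Pβ Hβ Pα Hα) = Composition.compose-SIF 0<g g<j 0<k Pβ Hβ Pα Hα

  splitting-block : (c : Splitting m) →
                    let open Splitting c using (g; k) in ProperStab m (remove m (permutation c)) g (g + k)
  splitting-block (splitting j g k β α 0<g g<j 0<k refl Pβ Hβ Pα Hα) =
    m<m+n g 0<k , <⇒≤ (+-monoˡ-< k g<j) , (λ (g≡0 , _) → <⇒≢ 0<g (sym g≡0)) ,
    Composition.remove-stab-block 0<g g<j 0<k Pβ Hβ Pα Hα

  splitting-within-block : (c : Splitting m) → let open Splitting c using (g; k) in
    ∀ {p q} → ProperStab m (remove m (permutation c)) p q → g ≤ p × q ≤ g + k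
  splitting-within-block (splitting j g k β α 0<g g<j 0<k refl Pβ Hβ Pα Hα) =
    Composition.stab-within-block 0<g g<j 0<k Pβ Hβ Pα Hα

  splitting-remove-not-SIF : (c : Splitting m) → ¬ SIF m (remove m (permutation c))
  splitting-remove-not-SIF c H = let p<q , q≤m , proper , S = splitting-block c in proper (H p<q q≤m S)

  -- Both splittings' blocks are proper stabilized intervals of the same permutation,
  -- and each contains every such interval.
  splitting-determined : (c c′ : Splitting m) → permutation c ≈[ suc m ] permutation c′ →
                         Splitting.j c ≡ Splitting.j c′ × Splitting.g c ≡ Splitting.g c′
  splitting-determined c c′ c≈c′ = j≡j′ , g≡g′
    where
      open Splitting c using (j; g; k; j+k≡m)
      open Splitting c′ using () renaming (j to j′; g to g′; k to k′; j+k≡m to j′+k′≡m)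
      c′-inside-c : g ≤ g′ × g′ + k′ ≤ g + k
      c′-inside-c = splitting-within-block c (properStab-resp (≈-sym (remove-resp c≈c′)) (splitting-block c′))
      c-inside-c′ : g′ ≤ g × g + k ≤ g′ + k′
      c-inside-c′ = splitting-within-block c′ (properStab-resp (remove-resp c≈c′) (splitting-block c))
      g≡g′ : g ≡ g′
      g≡g′ = ≤-antisym (proj₁ c′-inside-c) (proj₁ c-inside-c′)
      k≡k′ : k ≡ k′
      k≡k′ = +-cancelˡ-≡ g k k′ (trans (≤-antisym (proj₂ c-inside-c′) (proj₂ c′-inside-c)) (cong (_+ k′) (sym g≡g′)))
      j≡j′ : j ≡ j′
      j≡j′ = +-cancelʳ-≡ k j j′ (trans j+k≡m (trans (sym j′+k′≡m) (cong (j′ +_) (sym k≡k′))))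

  decompose : ∀ {σ} → Perm (suc m) σ → SIF (suc m) σ → ∀ {p q} → ProperStab m (remove m σ) p q →
              ∃ λ (c : Splitting m) → permutation c ≈[ suc m ] σ
  decompose {σ} Pσ Hσ PS with surjective Pσ (≤-refl {suc m})
                          | longest (properStab? m (remove m σ)) (λ (p<q , q≤m , _) → <⇒≤ p<q , q≤m) PS
  ... | i , i<1+m , σi≡m | g , k , K , leftmost = split (m∸n+n≡m k≤m) Pσ Hσ i<1+m σi≡m K leftmost
    where
      k≤m : k ≤ m
      k≤m = ≤-trans (m≤n+m k g) (proj₁ (proj₂ K))
      split : ∀ {j} → (j+k≡m : j + k ≡ m) → Perm (suc m) σ → SIF (suc m) σ → ∀ {i} → i < suc m → σ i ≡ m →
              ProperStab m (remove m σ) g (g + k) →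
              (∀ {p q} → p ≤ g → g + k ≤ q → ProperStab m (remove m σ) p q → p ≡ g) →
              ∃ λ (c : Splitting m) → permutation c ≈[ suc m ] σ
      split {j} refl Pσ Hσ i<1+m σi≡m K leftmost =
        splitting j g k β α 0<g g<j 0<k refl β-perm β-SIF α-perm α-SIF , compose-restrict
        where open Decomposition Pσ Hσ i<1+m σi≡m K leftmost

SIF⊎properStab : ∀ n f → SIF n f ⊎ ∃ λ p → ∃ λ q → ProperStab n f p q
SIF⊎properStab n f with anyUpTo? (λ q → anyUpTo? (λ p → properStab? n f p q) (suc n)) (suc n)
... | yes (q , _ , p , _ , PS) = inj₂ (p , q , PS)
... | no none = inj₁ SIF-f
  where
    SIF-f : SIF n f
    SIF-f {p} {q} p<q q≤n S with (p ≟ 0) ×-dec (q ≟ n)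
    ... | yes whole = whole
    ... | no proper = ⊥-elim (none (q , s≤s q≤n , p , <-≤-trans p<q (m≤n⇒m≤1+n q≤n) , p<q , q≤n , proper , S))

module _ {m : ℕ} where

  private
    same-shape : ∀ {j k k′} → j + k ≡ m → j + k′ ≡ m → k ≡ k′
    same-shape {j} {k = k} {k′} j+k≡m j+k′≡m = +-cancelˡ-≡ j k k′ (trans j+k≡m (sym j+k′≡m))

  splitting-injective : (c c′ : Splitting m) → permutation c ≈[ suc m ] permutation c′ →
    Splitting.β c ≈[ suc (Splitting.k c) ] Splitting.β c′ × Splitting.α c ≈[ Splitting.j c ] Splitting.α c′
  splitting-injective c c′ c≈c′ with splitting-determined c c′ c≈c′
  splitting-injective (splitting j g k β α _ g<j _ refl Pβ _ Pα _) (splitting j g k′ β′ α′ _ _ _ j+k′≡m Pβ′ _ Pα′ _) c≈c′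
    | refl , refl with same-shape {j} refl j+k′≡m
  ... | refl = glue-injective (bounded Pβ) (bounded Pβ′) (bounded Pα) (bounded Pα′) c≈c′
    where open Gluing (InBlock? g k j) (block-indexing g<j) (rest-indexing g<j)

  splitting-resp : (c c′ : Splitting m) → Splitting.j c ≡ Splitting.j c′ → Splitting.g c ≡ Splitting.g c′ →
    Splitting.β c ≈[ suc (Splitting.k c) ] Splitting.β c′ → Splitting.α c ≈[ Splitting.j c ] Splitting.α c′ →
    permutation c ≈[ suc m ] permutation c′
  splitting-resp (splitting j g k β α _ g<j _ refl _ _ _ _) (splitting j g k′ β′ α′ _ _ _ j+k′≡m _ _ _ _) refl refl β≈β′ α≈α′
    with same-shape {j} refl j+k′≡m
  ... | refl = glue-resp β≈β′ α≈α′
    where open Gluing (InBlock? g k j) (block-indexing g<j) (rest-indexing g<j)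

-- Beyond the length of the vector the value 0 is junk.
toFun : ∀ {n k} → Vec (Fin n) k → ℕ → ℕ
toFun [] _ = 0
toFun (e ∷ v) zero = toℕ e
toFun (e ∷ v) (suc x) = toFun v x

toFun-lookup : ∀ {n k} (v : Vec (Fin n) k) (i : Fin k) → toFun v (toℕ i) ≡ toℕ (lookup v i)
toFun-lookup (e ∷ v) fzero = refl
toFun-lookup (e ∷ v) (fsuc i) = toFun-lookup v i

toFun-lookup< : ∀ {n k} (v : Vec (Fin n) k) {x} (x<k : x < k) → toFun v x ≡ toℕ (lookup v (fromℕ< x<k))
toFun-lookup< v x<k = trans (cong (toFun v) (sym (toℕ-fromℕ< x<k))) (toFun-lookup v (fromℕ< x<k))

toFun-< : ∀ {n k} (v : Vec (Fin n) k) {x} → x < k → toFun v x < n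
toFun-< v x<k = subst (_< _) (sym (toFun-lookup< v x<k)) (toℕ<n _)

toFun-injective : ∀ {n k} (v w : Vec (Fin n) k) → toFun v ≈[ k ] toFun w → v ≡ w
toFun-injective [] [] _ = refl
toFun-injective (d ∷ v) (e ∷ w) v≈w =
  cong₂ _∷_ (toℕ-injective (v≈w (s≤s z≤n))) (toFun-injective v w (λ x<k → v≈w (s≤s x<k)))

fromℕ<-or : ∀ {n} → ℕ → Fin n → Fin n
fromℕ<-or {n} y default with y <? n
... | yes y<n = fromℕ< y<n
... | no _ = default

fromFun : (n : ℕ) → (ℕ → ℕ) → Vec (Fin n) n
fromFun n f = tabulate (λ i → fromℕ<-or (f (toℕ i)) i)

toFun-fromFun : ∀ {n f} → Bounded n f → toFun (fromFun n f) ≈[ n ] f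
toFun-fromFun {n} {f} f< {x} x<n = begin
  toFun (fromFun n f) x                                  ≡⟨ toFun-lookup< (fromFun n f) x<n ⟩
  toℕ (lookup (fromFun n f) (fromℕ< x<n))                ≡⟨ cong toℕ (lookup∘tabulate _ (fromℕ< x<n)) ⟩
  toℕ (fromℕ<-or (f (toℕ (fromℕ< x<n))) (fromℕ< x<n))
    ≡⟨ cong (λ y → toℕ (fromℕ<-or (f y) (fromℕ< x<n))) (toℕ-fromℕ< x<n) ⟩
  toℕ (fromℕ<-or (f x) (fromℕ< x<n))                     ≡⟨ in-range (f< x<n) ⟩
  f x                                                    ∎
  where
    open ≡-Reasoning
    in-range : ∀ {y} {d : Fin n} → y < n → toℕ (fromℕ<-or y d) ≡ y
    in-range {y} y<n with y <? n
    ... | yes y<n′ = toℕ-fromℕ< y<n′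
    ... | no y≮n = ⊥-elim (y≮n y<n)

module _ {n : ℕ} (v : Vec (Fin n) n) where

  isPerm⇒perm : IsPerm v → Perm n (toFun v)
  isPerm⇒perm (inj , surj) = record { bounded = toFun-< v ; injective = injective′ ; surjective = surjective′ }
    where
      injective′ : ∀ {x y} → x < n → y < n → toFun v x ≡ toFun v y → x ≡ y
      injective′ x<n y<n eq = begin
        _                ≡⟨ toℕ-fromℕ< x<n ⟨
        toℕ (fromℕ< x<n) ≡⟨ cong toℕ (inj _ _ (toℕ-injective
                              (trans (sym (toFun-lookup< v x<n)) (trans eq (toFun-lookup< v y<n))))) ⟩
        toℕ (fromℕ< y<n) ≡⟨ toℕ-fromℕ< y<n ⟩
        _                ∎
        where open ≡-Reasoning
      surjective′ : ∀ {y} → y < n → ∃ λ x → x < n × toFun v x ≡ y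
      surjective′ y<n with surj (fromℕ< y<n)
      ... | i , vi≡y = toℕ i , toℕ<n i , trans (toFun-lookup v i) (trans (cong toℕ vi≡y) (toℕ-fromℕ< y<n))

  perm⇒isPerm : Perm n (toFun v) → IsPerm v
  perm⇒isPerm P = inj , surj
    where
      inj : ∀ x y → lookup v x ≡ lookup v y → x ≡ y
      inj x y eq = toℕ-injective (injective P (toℕ<n x) (toℕ<n y)
                     (trans (toFun-lookup v x) (trans (cong toℕ eq) (sym (toFun-lookup v y)))))
      surj : ∀ y → ∃ λ x → lookup v x ≡ y
      surj y with surjective P (toℕ<n y)
      ... | x , x<n , vx≡y = fromℕ< x<n , toℕ-injective (trans (sym (toFun-lookup< v x<n)) vx≡y)

  private
    to∈ : ∀ {i j x : Fin n} → InInterval i j x → toℕ x ∈[ toℕ i , suc (toℕ j) ⟩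
    to∈ (i≤x , x≤j) = i≤x , s≤s x≤j

    from∈ : ∀ {i j x : Fin n} → toℕ x ∈[ toℕ i , suc (toℕ j) ⟩ → InInterval i j x
    from∈ (i≤x , x<1+j) = i≤x , ≤-pred x<1+j

  stabilizes⇒stab : ∀ {i j} → Stabilizes v i j → Stab (toFun v) (toℕ i) (suc (toℕ j))
  stabilizes⇒stab {i} {j} (into′ , onto′) = record { into = into″ ; onto = onto″ }
    where
      <n : ∀ {x} → x ∈[ toℕ i , suc (toℕ j) ⟩ → x < n
      <n x∈ = <-≤-trans (proj₂ x∈) (toℕ<n j)
      as-Fin : ∀ {x} (x∈ : x ∈[ toℕ i , suc (toℕ j) ⟩) → InInterval i j (fromℕ< (<n x∈))
      as-Fin x∈ = from∈ (subst (_∈[ toℕ i , suc (toℕ j) ⟩) (sym (toℕ-fromℕ< (<n x∈))) x∈)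
      into″ : ∀ {x} → x ∈[ toℕ i , suc (toℕ j) ⟩ → toFun v x ∈[ toℕ i , suc (toℕ j) ⟩
      into″ x∈ = subst (_∈[ toℕ i , suc (toℕ j) ⟩) (sym (toFun-lookup< v (<n x∈))) (to∈ (into′ _ (as-Fin x∈)))
      onto″ : ∀ {y} → y ∈[ toℕ i , suc (toℕ j) ⟩ → ∃ λ x → x ∈[ toℕ i , suc (toℕ j) ⟩ × toFun v x ≡ y
      onto″ y∈ with onto′ _ (as-Fin y∈)
      ... | x , x∈ , vx≡y = toℕ x , to∈ x∈ , trans (toFun-lookup v x) (trans (cong toℕ vx≡y) (toℕ-fromℕ< (<n y∈)))

  stab⇒stabilizes : ∀ {i j} → Stab (toFun v) (toℕ i) (suc (toℕ j)) → Stabilizes v i j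
  stab⇒stabilizes {i} {j} S = into′ , onto′
    where
      into′ : ∀ x → InInterval i j x → InInterval i j (lookup v x)
      into′ x x∈ = from∈ (subst (_∈[ toℕ i , suc (toℕ j) ⟩) (toFun-lookup v x) (into S (to∈ x∈)))
      onto′ : ∀ y → InInterval i j y → ∃ λ x → InInterval i j x × lookup v x ≡ y
      onto′ y y∈ with onto S (to∈ y∈)
      ... | x , x∈ , vx≡y = fromℕ< x<n ,
                            from∈ (subst (_∈[ toℕ i , suc (toℕ j) ⟩) (sym (toℕ-fromℕ< x<n)) x∈) ,
                            toℕ-injective (trans (sym (toFun-lookup< v x<n)) vx≡y)
        where
          x<n : x < n
          x<n = <-≤-trans (proj₂ x∈) (toℕ<n j)

  SIF⇒isSIF : SIF n (toFun v) → IsSIF v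
  SIF⇒isSIF H i j i≤j ¬whole St = ¬whole (H (s≤s i≤j) (toℕ<n j) (stabilizes⇒stab St))

  isSIF⇒SIF : IsSIF v → SIF n (toFun v)
  isSIF⇒SIF H {p} {suc q} p<q q<n S with (p ≟ 0) ×-dec (suc q ≟ n)
  ... | yes whole = whole
  ... | no proper = ⊥-elim (H i j i≤j ¬whole (stab⇒stabilizes (subst₂ (Stab (toFun v)) (sym ti) (cong suc (sym tj)) S)))
    where
      i j : Fin n
      i = fromℕ< (<-≤-trans p<q q<n)
      j = fromℕ< q<n
      ti : toℕ i ≡ p
      ti = toℕ-fromℕ< (<-≤-trans p<q q<n)
      tj : toℕ j ≡ q
      tj = toℕ-fromℕ< q<n
      i≤j : i Fin.≤ j
      i≤j = subst₂ _≤_ (sym ti) (sym tj) (≤-pred p<q)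
      ¬whole : ¬ IsWhole i j
      ¬whole (i≡0 , 1+j≡n) = proper (trans (sym ti) i≡0 , trans (cong suc (sym tj)) 1+j≡n)

allVecs-complete : ∀ n k (v : Vec (Fin n) k) → v ∈ allVecs n k
allVecs-complete n zero [] = here refl
allVecs-complete n (suc k) (x ∷ v) =
  ∈-concatMap⁺ (λ x → map (x ∷_) (allVecs n k)) (lose (∈-allFin x) (∈-map⁺ (x ∷_) (allVecs-complete n k v)))

allVecs-unique : ∀ n k → Unique (allVecs n k)
allVecs-unique n zero = [] ∷ []
allVecs-unique n (suc k) =
  concatMap-unique (λ x → map (x ∷_) (allVecs n k)) (allFin⁺ n) (λ _ → map⁺ ∷-injectiveʳ (allVecs-unique n k)) same-head
  where
    same-head : ∀ {x y z} → x ∈ allFin n → y ∈ allFin n →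
                z ∈ map (x ∷_) (allVecs n k) → z ∈ map (y ∷_) (allVecs n k) → x ≡ y
    same-head _ _ z∈ z∈′ with ∈-map⁻ _ z∈ | ∈-map⁻ _ z∈′
    ... | _ , _ , refl | _ , _ , z≡ = ∷-injectiveˡ z≡

-- Abstract only so that type checking never unfolds the enumeration of all vectors.
abstract
  SIFs : (n : ℕ) → List (Vec (Fin n) n)
  SIFs n = filter isSIFPerm? (allVecs n n)

  length-SIFs : ∀ n → length (SIFs n) ≡ a n
  length-SIFs n = refl

  SIFs-unique : ∀ n → Unique (SIFs n)
  SIFs-unique n = filter⁺ isSIFPerm? (allVecs-unique n n)

  ∈SIFs⁺ : ∀ {n} {v : Vec (Fin n) n} → Perm n (toFun v) → SIF n (toFun v) → v ∈ SIFs n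
  ∈SIFs⁺ {n} {v} P H = ∈-filter⁺ isSIFPerm? (allVecs-complete n n v) (perm⇒isPerm v P , SIF⇒isSIF v H)

  ∈SIFs⁻ : ∀ {n} {v : Vec (Fin n) n} → v ∈ SIFs n → Perm n (toFun v) × SIF n (toFun v)
  ∈SIFs⁻ {n} {v} v∈ = let _ , isP , isS = ∈-filter⁻ isSIFPerm? {xs = allVecs n n} v∈ in
                      isPerm⇒perm v isP , isSIF⇒SIF v isS

fromFun∈SIFs : ∀ {n f} → Perm n f → SIF n f → fromFun n f ∈ SIFs n
fromFun∈SIFs {n} {f} P H = ∈SIFs⁺ (perm-resp f≈ P) (SIF-resp f≈ H)
  where
    f≈ : f ≈[ n ] toFun (fromFun n f)
    f≈ = ≈-sym (toFun-fromFun (bounded P))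

insertVec : (m : ℕ) → Vec (Fin m) m → Fin m → Vec (Fin (suc m)) (suc m)
insertVec m τv i = fromFun (suc m) (insert m (toFun τv) (toℕ i))

insertions : (m : ℕ) → List (Vec (Fin (suc m)) (suc m))
insertions m = cartesianProductWith (insertVec m) (SIFs m) (allFin m)

module _ {m : ℕ} where

  toFun-insertVec : ∀ τv i → toFun (insertVec m τv i) ≈[ suc m ] insert m (toFun τv) (toℕ i)
  toFun-insertVec τv i = toFun-fromFun (insert-bounded (toFun-< τv) (toℕ<n i))

  insertVec-injective : ∀ {τv τv′ i i′} → insertVec m τv i ≡ insertVec m τv′ i′ → τv ≡ τv′ × i ≡ i′
  insertVec-injective {τv} {τv′} {i} {i′} eq =
    toFun-injective τv τv′ τ≈τ′ , toℕ-injective (insert-injectiveʳ (toFun-< τv′) (toℕ<n i) (toℕ<n i′) σ≈σ′)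
    where
      σ≈σ′ : insert m (toFun τv) (toℕ i) ≈[ suc m ] insert m (toFun τv′) (toℕ i′)
      σ≈σ′ {x} x<1+m = trans (sym (toFun-insertVec τv i x<1+m))
                             (trans (cong (λ v → toFun v x) eq) (toFun-insertVec τv′ i′ x<1+m))
      τ≈τ′ : toFun τv ≈[ m ] toFun τv′
      τ≈τ′ x<m = trans (sym (remove-insert (toFun-< τv) (toℕ<n i) x<m))
                   (trans (remove-resp σ≈σ′ x<m) (remove-insert (toFun-< τv′) (toℕ<n i′) x<m))

  length-insertions : length (insertions m) ≡ m * a m
  length-insertions = trans (length-cartesianProductWith (insertVec m) (SIFs m) (allFin m))
                            (trans (cong₂ _*_ (length-SIFs m) (length-tabulate {n = m} (λ i → i))) (*-comm (a m) m))

  insertions-unique : Unique (insertions m)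
  insertions-unique = cartesianProductWith⁺ (insertVec m) insertVec-injective (SIFs-unique m) (allFin⁺ m)

  ∈insertions⇒ : ∀ {σv} → σv ∈ insertions m → σv ∈ SIFs (suc m) × SIF m (remove m (toFun σv))
  ∈insertions⇒ σv∈ with ∈-cartesianProductWith⁻ (insertVec m) (SIFs m) (allFin m) σv∈
  ... | τv , i , τv∈ , _ , refl =
    fromFun∈SIFs (insert-perm Pτ (toℕ<n i)) (insert-SIF Pτ Hτ (toℕ<n i)) ,
    SIF-resp (λ x<m → trans (sym (remove-insert (toFun-< τv) (toℕ<n i) x<m))
                            (remove-resp (≈-sym (toFun-insertVec τv i)) x<m)) Hτ
    where
      Pτ : Perm m (toFun τv)
      Pτ = proj₁ (∈SIFs⁻ τv∈)
      Hτ : SIF m (toFun τv)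
      Hτ = proj₂ (∈SIFs⁻ τv∈)

  ∈insertions⁺ : ∀ {σv} → 0 < m → σv ∈ SIFs (suc m) → SIF m (remove m (toFun σv)) → σv ∈ insertions m
  ∈insertions⁺ {σv} 0<m σv∈ Hτ =
    subst (_∈ insertions m) (sym σv≡) (∈-cartesianProductWith⁺ (insertVec m) τv∈ (∈-allFin (fromℕ< i<m)))
    where
      σ : ℕ → ℕ
      σ = toFun σv
      Pσ : Perm (suc m) σ
      Pσ = proj₁ (∈SIFs⁻ σv∈)
      preimage : ∃ λ i → i < suc m × σ i ≡ m
      preimage = surjective Pσ ≤-refl
      i : ℕ
      i = proj₁ preimage
      σi≡m : σ i ≡ m
      σi≡m = proj₂ (proj₂ preimage)
      σm≢m : σ m ≢ m
      σm≢m = SIF⇒top-moves 0<m (proj₂ (∈SIFs⁻ σv∈))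
      i<m : i < m
      i<m = m<1+n∧m≢n⇒m<n (proj₁ (proj₂ preimage)) (λ i≡m → σm≢m (subst (λ x → σ x ≡ m) i≡m σi≡m))
      τv : Vec (Fin m) m
      τv = fromFun m (remove m σ)
      τv∈ : τv ∈ SIFs m
      τv∈ = fromFun∈SIFs (remove-perm Pσ) Hτ
      σv≡ : σv ≡ insertVec m τv (fromℕ< i<m)
      σv≡ = toFun-injective σv _ λ {x} x<1+m → sym (begin
        toFun (insertVec m τv (fromℕ< i<m)) x           ≡⟨ toFun-insertVec τv (fromℕ< i<m) x<1+m ⟩
        insert m (toFun τv) (toℕ (fromℕ< i<m)) x        ≡⟨ cong (λ i → insert m (toFun τv) i x) (toℕ-fromℕ< i<m) ⟩
        insert m (toFun τv) i x                         ≡⟨ insert-resp (toFun-fromFun (bounded (remove-perm Pσ))) i<m x<1+m ⟩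
        insert m (remove m σ) i x                       ≡⟨ insert-remove Pσ σm≢m (proj₁ (proj₂ preimage)) σi≡m x<1+m ⟩
        σ x                                             ∎)
        where open ≡-Reasoning

composeVec : (n j g : ℕ) {s : ℕ} → Vec (Fin j) j → Vec (Fin s) s → Vec (Fin n) n
composeVec n j g {s} αv βv = fromFun n (compose g (s ∸ 1) j (toFun βv) (toFun αv))

compositionsAt : (n j g : ℕ) → List (Vec (Fin n) n)
compositionsAt n j g = cartesianProductWith (composeVec n j g) (SIFs j) (SIFs (n ∸ j))

compositionsOfSize : (n j : ℕ) → List (Vec (Fin n) n)
compositionsOfSize n j = concatMap (λ g′ → compositionsAt n j (suc g′)) (upTo (j ∸ 1))

compositions : (n : ℕ) → List (Vec (Fin n) n)
compositions n = concatMap (λ t → compositionsOfSize n (2 + t)) (upTo (suc (n ∸ 2) ∸ 2))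

length-compositionsAt : ∀ n j g → length (compositionsAt n j g) ≡ a j * a (n ∸ j)
length-compositionsAt n j g = trans (length-cartesianProductWith (composeVec n j g) (SIFs j) (SIFs (n ∸ j)))
                                    (cong₂ _*_ (length-SIFs j) (length-SIFs (n ∸ j)))

length-compositionsOfSize : ∀ n j → length (compositionsOfSize n j) ≡ (j ∸ 1) * a j * a (n ∸ j)
length-compositionsOfSize n j = begin
  length (compositionsOfSize n j)            ≡⟨ length-concatMap-const (λ g′ → compositionsAt n j (suc g′))
                                                  (a j * a (n ∸ j)) (λ g′ → length-compositionsAt n j (suc g′))
                                                  (upTo (j ∸ 1)) ⟩
  length (upTo (j ∸ 1)) * (a j * a (n ∸ j))  ≡⟨ cong (_* (a j * a (n ∸ j))) (length-upTo (j ∸ 1)) ⟩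
  (j ∸ 1) * (a j * a (n ∸ j))                ≡⟨ *-assoc (j ∸ 1) (a j) (a (n ∸ j)) ⟨
  (j ∸ 1) * a j * a (n ∸ j)                  ∎
  where open ≡-Reasoning

length-compositions : ∀ n → length (compositions n) ≡ sumFromTo 2 (n ∸ 2) (λ j → (j ∸ 1) * a j * a (n ∸ j))
length-compositions n = trans (length-concatMap (λ t → compositionsOfSize n (2 + t)) (upTo (suc (n ∸ 2) ∸ 2)))
                              (cong sum (map-cong (λ t → length-compositionsOfSize n (2 + t)) (upTo (suc (n ∸ 2) ∸ 2))))

suc[m∸1]≡m : ∀ {m} → 0 < m → suc (m ∸ 1) ≡ m
suc[m∸1]≡m (s≤s _) = refl

splittingOf : ∀ {m j g s} {αv : Vec (Fin j) j} {βv : Vec (Fin s) s} → 0 < g → g < j → 1 < s → j + (s ∸ 1) ≡ m →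
              αv ∈ SIFs j → βv ∈ SIFs s → Splitting m
splittingOf {j = j} {g} {s} {αv} {βv} 0<g g<j 1<s j+k≡m αv∈ βv∈ =
  splitting j g (s ∸ 1) (toFun βv) (toFun αv) 0<g g<j (m<n⇒0<n∸m 1<s) j+k≡m
            (subst (λ s → Perm s (toFun βv)) (sym 1+k≡s) (proj₁ (∈SIFs⁻ βv∈)))
            (subst (λ s → SIF s (toFun βv)) (sym 1+k≡s) (proj₂ (∈SIFs⁻ βv∈)))
            (proj₁ (∈SIFs⁻ αv∈)) (proj₂ (∈SIFs⁻ αv∈))
  where
    1+k≡s : suc (s ∸ 1) ≡ s
    1+k≡s = suc[m∸1]≡m (<-trans z<s 1<s)

toFun-composeVec : ∀ {m j g s} {αv : Vec (Fin j) j} {βv : Vec (Fin s) s} (0<g : 0 < g) (g<j : g < j) (1<s : 1 < s)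
  (j+k≡m : j + (s ∸ 1) ≡ m) (αv∈ : αv ∈ SIFs j) (βv∈ : βv ∈ SIFs s) →
  toFun (composeVec (suc m) j g αv βv) ≈[ suc m ] permutation (splittingOf 0<g g<j 1<s j+k≡m αv∈ βv∈)
toFun-composeVec 0<g g<j 1<s j+k≡m αv∈ βv∈ = toFun-fromFun (bounded (splitting-perm (splittingOf 0<g g<j 1<s j+k≡m αv∈ βv∈)))

size-split : ∀ {m′ t} → t < m′ ∸ 1 → 1 < m′ ∸ t × 2 + t + (m′ ∸ t ∸ 1) ≡ suc m′
size-split {suc m″} {t} t<m″ rewrite +-∸-assoc 1 (<⇒≤ t<m″) =
  s≤s (m<n⇒0<n∸m t<m″) , cong (suc ∘ suc) (m+[n∸m]≡n (<⇒≤ t<m″))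

module _ {m′ : ℕ} where
  private
    m n : ℕ
    m = suc m′
    n = suc m

  ∈compositionsAt⁻ : ∀ {t g′ z} → t < m′ ∸ 1 → g′ < suc t → z ∈ compositionsAt n (2 + t) (suc g′) →
    ∃ λ (c : Splitting m) → Splitting.j c ≡ 2 + t × Splitting.g c ≡ suc g′ × toFun z ≈[ n ] permutation c
  ∈compositionsAt⁻ {t} {g′} {z} t< g′< z∈ =
    go (∈-cartesianProductWith⁻ (composeVec n (2 + t) (suc g′)) (SIFs (2 + t)) (SIFs (m′ ∸ t)) z∈)
    where
      1<s : 1 < m′ ∸ t
      1<s = proj₁ (size-split t<)
      j+k≡m : 2 + t + (m′ ∸ t ∸ 1) ≡ m
      j+k≡m = proj₂ (size-split t<)
      go : (∃ λ αv → ∃ λ βv → αv ∈ SIFs (2 + t) × βv ∈ SIFs (m′ ∸ t) × z ≡ composeVec n (2 + t) (suc g′) αv βv) →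
           ∃ λ (c : Splitting m) → Splitting.j c ≡ 2 + t × Splitting.g c ≡ suc g′ × toFun z ≈[ n ] permutation c
      go (αv , βv , αv∈ , βv∈ , refl) =
        splittingOf z<s (s≤s g′<) 1<s j+k≡m αv∈ βv∈ , refl , refl , toFun-composeVec z<s (s≤s g′<) 1<s j+k≡m αv∈ βv∈

  ∈compositionsOfSize⁻ : ∀ {t z} → t < m′ ∸ 1 → z ∈ compositionsOfSize n (2 + t) →
    ∃ λ (c : Splitting m) → Splitting.j c ≡ 2 + t × Splitting.g c < 2 + t × toFun z ≈[ n ] permutation c
  ∈compositionsOfSize⁻ {t} {z} t< z∈ = go (find (∈-concatMap⁻ (λ g′ → compositionsAt n (2 + t) (suc g′)) z∈))
    where
      go : (∃ λ g′ → g′ ∈ upTo (suc t) × z ∈ compositionsAt n (2 + t) (suc g′)) →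
           ∃ λ (c : Splitting m) → Splitting.j c ≡ 2 + t × Splitting.g c < 2 + t × toFun z ≈[ n ] permutation c
      go (g′ , g′∈ , z∈′) =
        let c , j≡ , g≡ , z≈c = ∈compositionsAt⁻ t< (∈-upTo⁻ g′∈) z∈′ in
        c , j≡ , subst (_< 2 + t) (sym g≡) (s≤s (∈-upTo⁻ g′∈)) , z≈c

  ∈compositions⁻ : ∀ {z} → z ∈ compositions n → ∃ λ (c : Splitting m) → toFun z ≈[ n ] permutation c
  ∈compositions⁻ {z} z∈ = go (find (∈-concatMap⁻ (λ t → compositionsOfSize n (2 + t)) z∈))
    where
      go : (∃ λ t → t ∈ upTo (m′ ∸ 1) × z ∈ compositionsOfSize n (2 + t)) →
           ∃ λ (c : Splitting m) → toFun z ≈[ n ] permutation c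
      go (t , t∈ , z∈′) = let c , _ , _ , z≈c = ∈compositionsOfSize⁻ (∈-upTo⁻ t∈) z∈′ in c , z≈c

  private
    shared : ∀ (z : Vec (Fin n) n) {c c′ : Splitting m} → toFun z ≈[ n ] permutation c → toFun z ≈[ n ] permutation c′ →
             permutation c ≈[ n ] permutation c′
    shared _ z≈c z≈c′ x<n = trans (sym (z≈c x<n)) (z≈c′ x<n)

  compositions-unique : Unique (compositions n)
  compositions-unique = concatMap-unique (λ t → compositionsOfSize n (2 + t)) (upTo⁺ _)
    (λ t∈ → ofSize-unique (∈-upTo⁻ t∈)) same-size
    where
      at-unique : ∀ {t g′} → t < m′ ∸ 1 → g′ < suc t → Unique (compositionsAt n (2 + t) (suc g′))
      at-unique {t} {g′} t< g′< =
        cartesianProductWith-unique (composeVec n (2 + t) (suc g′)) (SIFs-unique _) (SIFs-unique _) inj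
        where
          1<s : 1 < m′ ∸ t
          1<s = proj₁ (size-split t<)
          eq : 2 + t + (m′ ∸ t ∸ 1) ≡ m
          eq = proj₂ (size-split t<)
          inj : ∀ {αv αv′ βv βv′} → αv ∈ SIFs (2 + t) → αv′ ∈ SIFs (2 + t) → βv ∈ SIFs (m′ ∸ t) → βv′ ∈ SIFs (m′ ∸ t) →
                composeVec n (2 + t) (suc g′) αv βv ≡ composeVec n (2 + t) (suc g′) αv′ βv′ → αv ≡ αv′ × βv ≡ βv′
          inj {αv} {αv′} {βv} {βv′} αv∈ αv′∈ βv∈ βv′∈ eq′ =
            toFun-injective αv αv′ (proj₂ same) ,
            toFun-injective βv βv′ (λ {y} y<s → proj₁ same (subst (y <_) (sym (suc[m∸1]≡m (<-trans z<s 1<s))) y<s))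
            where
              c c′ : Splitting m
              c = splittingOf z<s (s≤s g′<) 1<s eq αv∈ βv∈
              c′ = splittingOf z<s (s≤s g′<) 1<s eq αv′∈ βv′∈
              same : toFun βv ≈[ suc (m′ ∸ t ∸ 1) ] toFun βv′ × toFun αv ≈[ 2 + t ] toFun αv′
              same = splitting-injective c c′ (shared (composeVec n (2 + t) (suc g′) αv βv) {c} {c′}
                       (toFun-composeVec z<s (s≤s g′<) 1<s eq αv∈ βv∈)
                       (subst (λ w → toFun w ≈[ n ] permutation c′) (sym eq′)
                         (toFun-composeVec z<s (s≤s g′<) 1<s eq αv′∈ βv′∈)))
      ofSize-unique : ∀ {t} → t < m′ ∸ 1 → Unique (compositionsOfSize n (2 + t))
      ofSize-unique {t} t< = concatMap-unique (λ g′ → compositionsAt n (2 + t) (suc g′)) (upTo⁺ _)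
        (λ g′∈ → at-unique t< (∈-upTo⁻ g′∈)) same-g
        where
          same-g : ∀ {g′ g″ z} → g′ ∈ upTo (suc t) → g″ ∈ upTo (suc t) →
                   z ∈ compositionsAt n (2 + t) (suc g′) → z ∈ compositionsAt n (2 + t) (suc g″) → g′ ≡ g″
          same-g {z = z} g′∈ g″∈ z∈ z∈′ =
            let c , _ , g≡ , z≈c = ∈compositionsAt⁻ t< (∈-upTo⁻ g′∈) z∈
                c′ , _ , g≡′ , z≈c′ = ∈compositionsAt⁻ t< (∈-upTo⁻ g″∈) z∈′ in
            suc-injective (trans (sym g≡) (trans (proj₂ (splitting-determined c c′ (shared z {c} {c′} z≈c z≈c′))) g≡′))
      same-size : ∀ {t t′ z} → t ∈ upTo (suc (n ∸ 2) ∸ 2) → t′ ∈ upTo (suc (n ∸ 2) ∸ 2) →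
                  z ∈ compositionsOfSize n (2 + t) → z ∈ compositionsOfSize n (2 + t′) → t ≡ t′
      same-size {z = z} t∈ t′∈ z∈ z∈′ =
        let c , j≡ , _ , z≈c = ∈compositionsOfSize⁻ (∈-upTo⁻ t∈) z∈
            c′ , j≡′ , _ , z≈c′ = ∈compositionsOfSize⁻ (∈-upTo⁻ t′∈) z∈′ in
        suc-injective (suc-injective
          (trans (sym j≡) (trans (proj₁ (splitting-determined c c′ (shared z {c} {c′} z≈c z≈c′))) j≡′)))

  ∈compositions⇒ : ∀ {z} → z ∈ compositions n → z ∈ SIFs n × ¬ SIF m (remove m (toFun z))
  ∈compositions⇒ z∈ =
    let c , z≈c = ∈compositions⁻ z∈ in
    ∈SIFs⁺ (perm-resp (≈-sym z≈c) (splitting-perm c)) (SIF-resp (≈-sym z≈c) (splitting-SIF c)) ,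
    λ H → splitting-remove-not-SIF c (SIF-resp (remove-resp z≈c) H)

  ∈compositions⁺ : (c : Splitting m) → ∀ {z} → toFun z ≈[ n ] permutation c → z ∈ compositions n
  ∈compositions⁺ (splitting zero _ _ _ _ _ () _ _ _ _ _ _)
  ∈compositions⁺ (splitting (suc zero) _ _ _ _ 0<g g<j _ _ _ _ _ _) = ⊥-elim (<⇒≱ 0<g (≤-pred g<j))
  ∈compositions⁺ (splitting (suc (suc t)) zero _ _ _ () _ _ _ _ _ _ _)
  ∈compositions⁺ c@(splitting (suc (suc t)) (suc g′) k β α _ g<j 0<k j+k≡m Pβ Hβ Pα Hα) {z} z≈c =
    subst (_∈ compositions n) (sym z≡z₀) z₀∈
    where
      m′≡ : m′ ≡ suc (t + k)
      m′≡ = sym (suc-injective j+k≡m)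
      t< : t < m′ ∸ 1
      t< = subst (t <_) (sym (cong (_∸ 1) m′≡)) (m<m+n t 0<k)
      g′< : g′ < suc t
      g′< = ≤-pred g<j
      s≡ : m′ ∸ t ≡ suc k
      s≡ = trans (cong (_∸ t) (trans m′≡ (sym (+-suc t k)))) (m+n∸m≡n t (suc k))
      Pβ′ : Perm (m′ ∸ t) β
      Pβ′ = subst (λ s → Perm s β) (sym s≡) Pβ
      αv : Vec (Fin (2 + t)) (2 + t)
      αv = fromFun (2 + t) α
      βv : Vec (Fin (m′ ∸ t)) (m′ ∸ t)
      βv = fromFun (m′ ∸ t) β
      αv∈ : αv ∈ SIFs (2 + t)
      αv∈ = fromFun∈SIFs Pα Hα
      βv∈ : βv ∈ SIFs (m′ ∸ t)
      βv∈ = fromFun∈SIFs Pβ′ (subst (λ s → SIF s β) (sym s≡) Hβ)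
      z₀ : Vec (Fin n) n
      z₀ = composeVec n (2 + t) (suc g′) αv βv
      z₀∈ : z₀ ∈ compositions n
      z₀∈ = ∈-concatMap⁺ (λ t → compositionsOfSize n (2 + t)) (lose (∈-upTo⁺ t<)
              (∈-concatMap⁺ (λ g′ → compositionsAt n (2 + t) (suc g′)) (lose (∈-upTo⁺ g′<)
                (∈-cartesianProductWith⁺ (composeVec n (2 + t) (suc g′)) αv∈ βv∈))))
      c₀ : Splitting m
      c₀ = splittingOf z<s (s≤s g′<) (proj₁ (size-split t<)) (proj₂ (size-split t<)) αv∈ βv∈
      β≈ : β ≈[ suc k ] toFun βv
      β≈ {y} y<1+k = sym (toFun-fromFun (bounded Pβ′) (subst (y <_) (sym s≡) y<1+k))
      c≈c₀ : permutation c ≈[ n ] permutation c₀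
      c≈c₀ = splitting-resp c c₀ refl refl β≈ (≈-sym (toFun-fromFun (bounded Pα)))
      z≡z₀ : z ≡ z₀
      z≡z₀ = toFun-injective z z₀ λ x<n →
        trans (z≈c x<n) (trans (c≈c₀ x<n)
          (sym (toFun-composeVec z<s (s≤s g′<) (proj₁ (size-split t<)) (proj₂ (size-split t<)) αv∈ βv∈ x<n)))

recurrence : ∀ m′ → let n = suc (suc m′) in
  a n ≡ sumFromTo 2 (n ∸ 2) (λ j → (j ∸ 1) * a j * a (n ∸ j)) + (n ∸ 1) * a (n ∸ 1)
recurrence m′ = begin
  a n                                             ≡⟨ length-SIFs n ⟨
  length (SIFs n)                                 ≡⟨ unique-⇔-length (SIFs-unique n) both-unique (mk⇔ split join) ⟩
  length (compositions n ++ insertions m)         ≡⟨ length-++ (compositions n) ⟩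
  length (compositions n) + length (insertions m) ≡⟨ cong₂ _+_ (length-compositions n) length-insertions ⟩
  sumFromTo 2 (n ∸ 2) (λ j → (j ∸ 1) * a j * a (n ∸ j)) + m * a m ∎
  where
    open ≡-Reasoning
    m n : ℕ
    m = suc m′
    n = suc m
    both-unique : Unique (compositions n ++ insertions m)
    both-unique = ++⁺ compositions-unique insertions-unique
      (λ (z∈c , z∈i) → proj₂ (∈compositions⇒ z∈c) (proj₂ (∈insertions⇒ z∈i)))
    split : ∀ {z} → z ∈ SIFs n → z ∈ compositions n ++ insertions m
    split {z} z∈ with SIF⊎properStab m (remove m (toFun z))
    ... | inj₁ H = ∈-++⁺ʳ (compositions n) (∈insertions⁺ z<s z∈ H)
    ... | inj₂ (_ , _ , PS) = let c , c≈z = decompose (proj₁ (∈SIFs⁻ z∈)) (proj₂ (∈SIFs⁻ z∈)) PS in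
                              ∈-++⁺ˡ (∈compositions⁺ c (≈-sym c≈z))
    join : ∀ {z} → z ∈ compositions n ++ insertions m → z ∈ SIFs n
    join z∈ with ∈-++⁻ (compositions n) z∈
    ... | inj₁ z∈c = proj₁ (∈compositions⇒ z∈c)
    ... | inj₂ z∈i = proj₁ (∈insertions⇒ z∈i)

mainTheorem2 : (a 0 ≡ 1) × (a 1 ≡ 1) ×
    (∀ (n : ℕ) → n ≥ 2 →
      a n ≡ sumFromTo 2 (n ∸ 2) (λ j → (j ∸ 1) * a j * a (n ∸ j)) + (n ∸ 1) * a (n ∸ 1))
mainTheorem2 = refl , refl , λ { zero () ; (suc zero) (s≤s ()) ; (suc (suc m′)) _ → recurrence m′ }
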